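{- Let $X$ be a connected Eulerian loopless multigraph. Then the following are equivalent: (1) No two (undirected) cycles of $X$ share an edge (i.e., $X$ is a bridgeless cactus multigraph). (2) Every edge of $X$ is contained in exactly one cycle. (3) $\mathcal{F}(X)$ is a partition of $X$ into cycles. (4) $X$ has a unique partition into cycles. (5) $X\in\mathcal{S}$. (6) $|E(X)|-|V(X)|+1=|\mathcal{F}(X)|$.
   Context: A multigraph is a triple $X=(V(X),E(X),\phi)$ with $V(X),E(X)$ finite and $\phi$ mapping each edge to a 2-element subset of $V(X)$ (no loops; parallel edges allowed). $X$ is Eulerian if it has a closed trail traversing every edge exactly once. An (undirected) cycle is a connected multigraph in which every vertex has degree $2$ (so length $\ge 2$; two parallel edges form a digon). $\mathcal{F}(X)$ is the set of subgraphs of $X$ that are undirected cycles. A partition of $X$ into cycles is a set $\mathcal{A}\subseteq\mathcal{F}(X)$ whose edge sets partition $E(X)$. For multigraphs $X_1,X_2$ with exactly one common vertex, $X_1\ast X_2$ is their union; $\mathcal{S}$ is the closure of the collection of all finite undirected cycles under $\ast$. -}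

module Defs where

open import Level using (Level; 0ℓ) renaming (suc to lsuc)
open import Data.Nat using (ℕ)
open import Data.Integer using (ℤ; +_; _-_; _+_; 1ℤ)
open import Data.Fin using (Fin; _≟_)
open import Data.Fin.Subset using (Subset; _∈_; _∉_; _∪_; ⊤; Nonempty)
open import Data.Fin.Subset.Properties using (_∈?_)
open import Data.Product using (Σ; ∃; _×_; _,_; proj₁; proj₂)
open import Data.Sum using (_⊎_)
open import Data.List using (List; []; _∷_; length; filter; allFin)
open import Data.List.Relation.Unary.Unique.Propositional using (Unique)
open import Data.List.Membership.Propositional using () renaming (_∈_ to _∈ₗ_)
open import Relation.Binary.PropositionalEquality using (_≡_; _≢_)
open import Relation.Nullary using (Dec; ¬_)
open import Relation.Nullary.Decidable using (_×-dec_; _⊎-dec_)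
open import Function.Bundles using (_⇔_)

-- A finite loopless multigraph: vertex set Fin n, edge set Fin m,
-- each edge e has the two (distinct) endpoints ends e ; the pair is
-- read as the unordered 2-element set {proj₁ (ends e), proj₂ (ends e)}.
record Multigraph : Set where
  field
    nV       : ℕ
    nE       : ℕ
    ends     : Fin nE → Fin nV × Fin nV
    loopless : ∀ e → proj₁ (ends e) ≢ proj₂ (ends e)

module _ (X : Multigraph) where
  open Multigraph X

  V : Set
  V = Fin nV

  E : Set
  E = Fin nE

  Joins : E → V → V → Set
  Joins e u w = (ends e ≡ (u , w)) ⊎ (ends e ≡ (w , u))

  data Walk (Es : Subset nE) : V → V → Set where
    stop : ∀ {u} → Walk Es u u
    step : ∀ {u w v} (e : E) → e ∈ Es → Joins e u w → Walk Es w v → Walk Es u v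

  walkEdges : ∀ {Es u v} → Walk Es u v → List E
  walkEdges stop = []
  walkEdges (step e _ _ w) = e ∷ walkEdges w

  Connected : Set
  Connected = V × (∀ u v → Walk ⊤ u v)

  Eulerian : Set
  Eulerian = Σ V λ v → Σ (Walk ⊤ v v) λ t →
               Unique (walkEdges t) × (∀ e → e ∈ₗ walkEdges t)

  Sub : Set
  Sub = Subset nV × Subset nE

  verts : Sub → Subset nV
  verts = proj₁

  edges : Sub → Subset nE
  edges = proj₂

  IsSubgraph : Sub → Set
  IsSubgraph H = ∀ e → e ∈ edges H →
                   proj₁ (ends e) ∈ verts H × proj₂ (ends e) ∈ verts H

  Incident : V → E → Set
  Incident v e = (v ≡ proj₁ (ends e)) ⊎ (v ≡ proj₂ (ends e))

  deg : Subset nE → V → ℕ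
  deg Es v = length (filter (λ e → (e ∈? Es) ×-dec ((v ≟ proj₁ (ends e)) ⊎-dec (v ≟ proj₂ (ends e)))) (allFin nE))

  SubConnected : Sub → Set
  SubConnected H = Nonempty (verts H) ×
                   (∀ u v → u ∈ verts H → v ∈ verts H → Walk (edges H) u v)

  IsCycle : Sub → Set
  IsCycle H = IsSubgraph H × SubConnected H × (∀ v → v ∈ verts H → deg (edges H) v ≡ 2)

  IsPartition : (Sub → Set) → Set
  IsPartition A = (∀ H → A H → IsCycle H) ×
                  (∀ e → Σ Sub λ H → A H × e ∈ edges H ×
                         (∀ H' → A H' → e ∈ edges H' → H' ≡ H))

  -- subgraphs of X lying in the class 𝒮 (closure of cycles under ∗)
  data InS : Sub → Set where
    cyc  : ∀ {H} → IsCycle H → InS H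
    join : ∀ {H₁ H₂ H} → InS H₁ → InS H₂ →
           (Σ V λ w → ∀ u → (u ∈ verts H₁ × u ∈ verts H₂) ⇔ (u ≡ w)) →
           verts H ≡ verts H₁ ∪ verts H₂ → edges H ≡ edges H₁ ∪ edges H₂ →
           InS H

  HasCard : (Sub → Set) → ℕ → Set
  HasCard P k = Σ (List Sub) λ L → Unique L × (∀ H → (H ∈ₗ L) ⇔ P H) × length L ≡ k

  Cond1 Cond2 Cond3 Cond5 Cond6 : Set
  Cond1 = ∀ H H' → IsCycle H → IsCycle H' → H ≢ H' → ∀ e → e ∈ edges H → e ∉ edges H'
  Cond2 = ∀ e → Σ Sub λ H → IsCycle H × e ∈ edges H ×
                 (∀ H' → IsCycle H' → e ∈ edges H' → H' ≡ H)
  Cond3 = IsPartition IsCycle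
  Cond5 = InS (⊤ , ⊤)
  Cond6 = Σ ℕ λ k → HasCard IsCycle k × ((+ nE) - (+ nV) + 1ℤ ≡ + k)

  Cond4 : Set₁
  Cond4 = Σ (Sub → Set) λ A → IsPartition A ×
            (∀ B → IsPartition B → ∀ H → B H ⇔ A H)

{-# OPTIONS --safe #-}
module Submission where

-- An edge set in which every degree is even is an edge-disjoint union of cycles, and
-- by Euler's theorem E(X) is one; moreover a cycle whose edges lie in another cycle is that
-- cycle.  This gives (1) ⇔ (2) ⇔ (3) ⇔ (4): a cycle C together with a decomposition of
-- E(X) − E(C) is a partition, so a unique partition contains every cycle.  In X₁ ∗ X₂ the
-- edges of a cycle lying in X₁ form an even set (at the common vertex by the handshake
-- lemma), so the cycle lies in one factor and members of 𝒮 are cacti: (5) ⇒ (1).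
-- A spanning forest with c ≥ 1 components has |E| − |V| + c distinct fundamental cycles, and
-- if two cycles share an edge a cycle inside the symmetric difference of two fundamental
-- cycles is a further one: (6) ⇒ (1).  Finally, attach the cycles of a decomposition one at a
-- time, each meeting what is built so far; with k cycles and d shared vertices beyond one
-- per attachment, |V| + k + d = |E| + 1.  Under (1) these are all the cycles, so
-- k ≥ |E| − |V| + 1 forces d = 0: every attachment was a ∗-product, giving (5) and (6).

open import Defs
open import Data.Bool using (Bool; true; false; not; _∧_; _∨_; _xor_)
import Data.Bool.Properties as Bool
open import Data.Empty using (⊥; ⊥-elim)
open import Data.Fin using (Fin; zero; suc; _≟_; fromℕ<)
open import Data.Fin.Properties using (any?; all?; ¬∀⟶∃¬)
import Data.Fin.Properties as Fin
open import Data.Fin.Subset using (Subset; _∈_; _∉_; _⊆_; _∪_; ⊤)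
open import Data.Fin.Subset.Properties using (_∈?_; x∈p∪q⁻; x∈p∪q⁺; ∈⊤; ⊆⊤; ⊆-antisym)
open import Data.List using (List; []; _∷_; length; filter; map; allFin)
import Data.List as List
open import Data.List.Properties using (length-removeAt′; length-map)
open import Data.List.Membership.Propositional using () renaming (_∈_ to _∈ₗ_; _∉_ to _∉ₗ_)
open import Data.List.Membership.Propositional.Properties using (∈-allFin; ∈-map⁻; ∈-filter⁻)
import Data.List.Membership.DecPropositional as DecMembership
open import Data.List.Relation.Unary.All using (All; []; _∷_)
import Data.List.Relation.Unary.All as All
open import Data.List.Relation.Unary.All.Properties using (All¬⇒¬Any; ¬Any⇒All¬)
open import Data.List.Relation.Unary.Any using (here; there)
import Data.List.Relation.Unary.Any as Any
open import Data.List.Relation.Unary.Unique.Propositional using (Unique; []; _∷_)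
open import Data.List.Relation.Unary.Unique.Propositional.Properties using (allFin⁺; filter⁺)
open import Data.Nat using (ℕ; zero; suc; _+_; _∸_; _≤_; _<_; z≤n; s≤s; parity; ⌊_/2⌋)
open import Data.Nat.Properties
  using ( +-assoc; +-cancelˡ-≤; +-comm; +-identityʳ; +-mono-≤; +-monoʳ-≤; +-monoˡ-<; +-monoˡ-≤; +-suc
        ; <-irrefl; <-≤-trans; m+[n∸m]≡n; m+n≡0⇒m≡0; m+n≡0⇒n≡0; m<m+n; n≡⌊n+n/2⌋; n≤0⇒n≡0
        ; suc-injective; ≤-pred; ≤-refl; ≤-reflexive; ≤-trans; +-0-commutativeMonoid; module ≤-Reasoning )
open import Algebra.Properties.CommutativeMonoid.Sum +-0-commutativeMonoid using (sum; sum-cong-≗; ∑-comm; ∑-distrib-+)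
open import Data.Nat.Tactic.RingSolver using (solve-∀)
open import Data.Parity.Base using (0ℙ; 1ℙ; _⁻¹) renaming (_+_ to _+ℙ_)
open import Data.Parity.Properties using (+-homo-+; p+p≡0ℙ; suc-homo-⁻¹) renaming (+-identityʳ to +ℙ-identityʳ)
import Data.Product.Properties as Product
open import Data.Product using (Σ; ∃; _×_; _,_; proj₁; proj₂)
open import Data.Sum using (_⊎_; inj₁; inj₂; [_,_]′)
open import Data.Unit using () renaming (⊤ to ⊤′)
open import Data.Vec using (lookup; tabulate; _∷_)
import Data.Vec.Properties as Vec
open import Data.Vec.Properties using (lookup∘tabulate; []=⇒lookup; lookup⇒[]=; lookup-zipWith)
open import Function using (_∘_)
open import Function.Bundles using (_⇔_; mk⇔; Equivalence)
open import Relation.Binary.PropositionalEquality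
open import Relation.Nullary using (Dec; yes; no; does)
open import Relation.Nullary.Decidable using (_×-dec_; _⊎-dec_; dec-true; dec-false)
open import Relation.Unary using (Pred; Decidable)

iverson : Bool → ℕ
iverson false = 0
iverson true  = 1

-- Defined by recursion rather than as a library sum so that it stays rigid under unification;
-- count≡sum gives access to the library's lemmas about sums.
count : ∀ {n} → (Fin n → Bool) → ℕ
count {zero}  p = 0
count {suc n} p = iverson (p zero) + count (p ∘ suc)

count≡sum : ∀ {n} (p : Fin n → Bool) → count p ≡ sum (iverson ∘ p)
count≡sum {zero}  p = refl
count≡sum {suc n} p = cong (iverson (p zero) +_) (count≡sum (p ∘ suc))

_≐_ : ∀ {n} → Fin n → Fin n → Bool
i ≐ j = does (i ≟ j)

≐-true⇒≡ : ∀ {n} {i j : Fin n} → i ≐ j ≡ true → i ≡ j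
≐-true⇒≡ {i = i} {j} h with i ≟ j
... | yes i≡j = i≡j

≐-refl : ∀ {n} (i : Fin n) → i ≐ i ≡ true
≐-refl i with i ≟ i
... | yes _  = refl
... | no i≢i = ⊥-elim (i≢i refl)

from-does : ∀ {a} {A : Set a} {a? : Dec A} → does a? ≡ true → A
from-does {a? = yes a} _ = a

_⊆ᵇ_ : ∀ {n} → (Fin n → Bool) → (Fin n → Bool) → Set
p ⊆ᵇ q = ∀ i → p i ≡ true → q i ≡ true

_−_ : ∀ {n} → (Fin n → Bool) → (Fin n → Bool) → (Fin n → Bool)
(p − q) i = p i ∧ not (q i)

_∖_ : ∀ {n} → (Fin n → Bool) → Fin n → (Fin n → Bool)
p ∖ j = p − (_≐ j)

count-none : ∀ {n} {p : Fin n → Bool} → (∀ i → p i ≡ false) → count p ≡ 0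
count-none {zero}  none = refl
count-none {suc n} none rewrite none zero = count-none (none ∘ suc)

count-all : ∀ {n} {p : Fin n → Bool} → (∀ i → p i ≡ true) → count p ≡ n
count-all {zero}  _   = refl
count-all {suc n} all rewrite all zero = cong suc (count-all (all ∘ suc))

module _ {n : ℕ} where

  count-cong : {p q : Fin n → Bool} → (∀ i → p i ≡ q i) → count p ≡ count q
  count-cong {p} {q} p≗q = trans (count≡sum p) (trans (sum-cong-≗ (cong iverson ∘ p≗q)) (sym (count≡sum q)))

  count-+ : (p q : Fin n → Bool) → count p + count q ≡ sum (λ i → iverson (p i) + iverson (q i))
  count-+ p q = trans (cong₂ _+_ (count≡sum p) (count≡sum q)) (sym (∑-distrib-+ (iverson ∘ p) (iverson ∘ q)))

  count-∨-∧ : (p q : Fin n → Bool) → count (λ i → p i ∨ q i) + count (λ i → p i ∧ q i) ≡ count p + count q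
  count-∨-∧ p q = trans (count-+ _ _) (trans (sum-cong-≗ (λ i → pointwise (p i) (q i))) (sym (count-+ p q)))
    where
    pointwise : ∀ a b → iverson (a ∨ b) + iverson (a ∧ b) ≡ iverson a + iverson b
    pointwise false false = refl
    pointwise false true  = refl
    pointwise true  false = refl
    pointwise true  true  = refl

  count-split : (p q : Fin n → Bool) → count p ≡ count (p − q) + count (λ i → p i ∧ q i)
  count-split p q = trans (count≡sum p) (trans (sum-cong-≗ (λ i → pointwise (p i) (q i))) (sym (count-+ _ _)))
    where
    pointwise : ∀ a b → iverson a ≡ iverson (a ∧ not b) + iverson (a ∧ b)
    pointwise false b     = refl
    pointwise true  false = refl
    pointwise true  true  = refl

  count-pos⁻ : (p : Fin n → Bool) → 0 < count p → ∃ λ i → p i ≡ true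
  count-pos⁻ p pos with any? (λ i → p i Bool.≟ true)
  ... | yes witness = witness
  ... | no  none    = ⊥-elim (<-irrefl (sym (count-none (λ i → Bool.¬-not (λ pi → none (i , pi))))) pos)

count-complement : ∀ {n} (p : Fin n → Bool) → count p + count (not ∘ p) ≡ n
count-complement {zero}  p = refl
count-complement {suc n} p with p zero
... | true  = cong suc (count-complement (p ∘ suc))
... | false = trans (+-suc (count (p ∘ suc)) _) (cong suc (count-complement (p ∘ suc)))

iverson-mono : ∀ {a b} → (a ≡ true → b ≡ true) → iverson a ≤ iverson b
iverson-mono {false} _   = z≤n
iverson-mono {true}  a⇒b rewrite a⇒b refl = ≤-refl

count-mono : ∀ {n} {p q : Fin n → Bool} → p ⊆ᵇ q → count p ≤ count q
count-mono {zero}  _   = z≤n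
count-mono {suc n} p⊆q = +-mono-≤ (iverson-mono (p⊆q zero)) (count-mono (p⊆q ∘ suc))

count-mono-reflects-≡ : ∀ {n} {p q : Fin n → Bool} → p ⊆ᵇ q → count p ≡ count q → q ⊆ᵇ p
count-mono-reflects-≡ {suc n} {p} {q} p⊆q eq i qi
  with p zero in p₀ | q zero in q₀ | p⊆q zero | count-mono {p = p ∘ suc} {q ∘ suc} (p⊆q ∘ suc)
... | true  | false | p₀⇒q₀ | _ with () ← p₀⇒q₀ refl
... | false | true  | _ | tail≤ = ⊥-elim (<-irrefl eq (s≤s tail≤))
count-mono-reflects-≡ {suc n} {p} {q} p⊆q eq zero qi | true | true | _ | _ = p₀
count-mono-reflects-≡ {suc n} {p} {q} p⊆q eq zero qi | false | false | _ | _ with () ← trans (sym qi) q₀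
count-mono-reflects-≡ {suc n} {p} {q} p⊆q eq (suc i) qi | true | true | _ | _ =
  count-mono-reflects-≡ (p⊆q ∘ suc) (suc-injective eq) i qi
count-mono-reflects-≡ {suc n} {p} {q} p⊆q eq (suc i) qi | false | false | _ | _ =
  count-mono-reflects-≡ (p⊆q ∘ suc) eq i qi

count-≐ : ∀ {n} (j : Fin n) → count (_≐ j) ≡ 1
count-≐ {suc n} zero    = cong suc (count-none {n} (λ _ → refl))
count-≐ {suc n} (suc j) = trans (count-cong (λ i → lemma i)) (count-≐ j)
  where
  lemma : ∀ i → suc i ≐ suc j ≡ i ≐ j
  lemma i with i ≟ j
  ... | yes _ = refl
  ... | no  _ = refl

count-pos⁺ : ∀ {n} (p : Fin n → Bool) {j} → p j ≡ true → 1 ≤ count p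
count-pos⁺ p {j} pj = subst (_≤ count p) (count-≐ j) (count-mono at-j)
  where
  at-j : (_≐ j) ⊆ᵇ p
  at-j i i≐j with refl ← ≐-true⇒≡ {i = i} {j} i≐j = pj

count-pair : ∀ {n} {i j : Fin n} → i ≢ j → count (λ k → k ≐ i ∨ k ≐ j) ≡ 2
count-pair {i = i} {j} i≢j = begin
  count (λ k → k ≐ i ∨ k ≐ j)                                  ≡⟨ sym (+-identityʳ _) ⟩
  count (λ k → k ≐ i ∨ k ≐ j) + 0                              ≡⟨ cong (count (λ k → k ≐ i ∨ k ≐ j) +_) (sym (count-none not-both)) ⟩
  count (λ k → k ≐ i ∨ k ≐ j) + count (λ k → k ≐ i ∧ k ≐ j)    ≡⟨ count-∨-∧ (_≐ i) (_≐ j) ⟩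
  count (_≐ i) + count (_≐ j)                                  ≡⟨ cong₂ _+_ (count-≐ i) (count-≐ j) ⟩
  2                                                            ∎
  where
  open ≡-Reasoning
  not-both : ∀ k → (k ≐ i ∧ k ≐ j) ≡ false
  not-both k with k ≟ i
  ... | yes refl = dec-false (k ≟ j) i≢j
  ... | no  _    = refl

count-at : ∀ {n} (p : Fin n → Bool) (j : Fin n) → count (λ i → p i ∧ i ≐ j) ≡ iverson (p j)
count-at p j with p j in pj
... | true  = trans (count-cong atJ) (count-≐ j)
  where
  atJ : ∀ i → (p i ∧ i ≐ j) ≡ i ≐ j
  atJ i with i ≟ j
  ... | yes refl = trans (Bool.∧-identityʳ _) pj
  ... | no  _    = Bool.∧-zeroʳ _
... | false = count-none onlyJ
  where
  onlyJ : ∀ i → (p i ∧ i ≐ j) ≡ false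
  onlyJ i with i ≟ j
  ... | yes refl = trans (Bool.∧-identityʳ _) pj
  ... | no  _    = Bool.∧-zeroʳ _

count-remove : ∀ {n} (p : Fin n → Bool) (j : Fin n) → count p ≡ iverson (p j) + count (p ∖ j)
count-remove p j = begin
  count p                                        ≡⟨ count-split p (_≐ j) ⟩
  count (p ∖ j) + count (λ i → p i ∧ i ≐ j)      ≡⟨ +-comm (count (p ∖ j)) _ ⟩
  count (λ i → p i ∧ i ≐ j) + count (p ∖ j)      ≡⟨ cong (_+ count (p ∖ j)) (count-at p j) ⟩
  iverson (p j) + count (p ∖ j)                  ∎
  where open ≡-Reasoning

count-∖ : ∀ {n} (p : Fin n → Bool) {j} → p j ≡ true → count p ≡ suc (count (p ∖ j))
count-∖ p {j} pj = trans (count-remove p j) (cong (λ b → iverson b + count (p ∖ j)) pj)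

count-−< : ∀ {n} (p q : Fin n → Bool) {j} → p j ≡ true → q j ≡ true → count (p − q) < count p
count-−< p q {j} pj qj = begin-strict
  count (p − q)                              <⟨ m<m+n (count (p − q)) (count-pos⁺ (λ i → p i ∧ q i) (trans (cong (_∧ q j) pj) qj)) ⟩
  count (p − q) + count (λ i → p i ∧ q i)    ≡⟨ sym (count-split p q) ⟩
  count p                                    ∎
  where open ≤-Reasoning

iverson-∨-disjoint : ∀ {a b} → (a ≡ true → b ≡ false) → iverson (a ∨ b) ≡ iverson a + iverson b
iverson-∨-disjoint {false}         _     = refl
iverson-∨-disjoint {true}  {false} _     = refl
iverson-∨-disjoint {true}  {true}  a⇒¬b with () ← a⇒¬b refl

xor-true : ∀ {a b} → a xor b ≡ true → a ≡ true ⊎ b ≡ true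
xor-true {true}          _ = inj₁ refl
xor-true {false} {true}  _ = inj₂ refl

count-xor : ∀ {n} (p q : Fin n → Bool) →
            count (λ i → p i xor q i) + (count (λ i → p i ∧ q i) + count (λ i → p i ∧ q i)) ≡ count p + count q
count-xor {n} p q = begin
  count (λ i → p i xor q i) + (count (λ i → p i ∧ q i) + count (λ i → p i ∧ q i))
    ≡⟨ cong (count (λ i → p i xor q i) +_) (count-+ (λ i → p i ∧ q i) (λ i → p i ∧ q i)) ⟩
  count (λ i → p i xor q i) + sum (λ i → iverson (p i ∧ q i) + iverson (p i ∧ q i))
    ≡⟨ cong (_+ sum (λ i → iverson (p i ∧ q i) + iverson (p i ∧ q i))) (count≡sum (λ i → p i xor q i)) ⟩
  sum (λ i → iverson (p i xor q i)) + sum (λ i → iverson (p i ∧ q i) + iverson (p i ∧ q i))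
    ≡⟨ sym (∑-distrib-+ (λ i → iverson (p i xor q i)) _) ⟩
  sum (λ i → iverson (p i xor q i) + (iverson (p i ∧ q i) + iverson (p i ∧ q i)))
    ≡⟨ sum-cong-≗ {n} (λ i → pointwise (p i) (q i)) ⟩
  sum (λ i → iverson (p i) + iverson (q i))
    ≡⟨ sym (count-+ p q) ⟩
  count p + count q
    ∎
  where
  open ≡-Reasoning
  pointwise : ∀ a b → iverson (a xor b) + (iverson (a ∧ b) + iverson (a ∧ b)) ≡ iverson a + iverson b
  pointwise false false = refl
  pointwise false true  = refl
  pointwise true  false = refl
  pointwise true  true  = refl

countₗ : ∀ {a} {A : Set a} → (A → Bool) → List A → ℕ
countₗ p []       = 0
countₗ p (x ∷ xs) = iverson (p x) + countₗ p xs

module _ {n : ℕ} where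
  open DecMembership (_≟_ {n}) using () renaming (_∈?_ to _∈ₗ?_)

  count-unique-list : ∀ {L} → Unique L → (p : Fin n → Bool) → count (λ i → does (i ∈ₗ? L) ∧ p i) ≡ countₗ p L
  count-unique-list {[]}    []          p = count-none {n} (λ _ → refl)
  count-unique-list {x ∷ L} (x∉L ∷ uL) p = begin
    count (λ i → does (i ∈ₗ? x ∷ L) ∧ p i)
      ≡⟨ count-remove _ x ⟩
    iverson (does (x ∈ₗ? x ∷ L) ∧ p x) + count (λ i → (does (i ∈ₗ? x ∷ L) ∧ p i) ∧ not (i ≐ x))
      ≡⟨ cong₂ _+_ (cong (λ b → iverson (b ∧ p x)) (dec-true (x ∈ₗ? x ∷ L) (here refl))) (count-cong drop-x) ⟩
    iverson (p x) + count (λ i → does (i ∈ₗ? L) ∧ p i)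
      ≡⟨ cong (iverson (p x) +_) (count-unique-list uL p) ⟩
    iverson (p x) + countₗ p L
      ∎
    where
    open ≡-Reasoning
    drop-x : ∀ i → (does (i ∈ₗ? x ∷ L) ∧ p i) ∧ not (i ≐ x) ≡ does (i ∈ₗ? L) ∧ p i
    drop-x i with i ≟ x
    ... | yes refl = trans (Bool.∧-zeroʳ _) (sym (cong (_∧ p x) (dec-false (x ∈ₗ? L) (All¬⇒¬Any x∉L))))
    ... | no _     = Bool.∧-identityʳ _

length-filter-tabulate : ∀ {a p} {A : Set a} {P : Pred A p} (P? : Decidable P) {n} (f : Fin n → A) →
  length (filter P? (List.tabulate f)) ≡ count (λ i → does (P? (f i)))
length-filter-tabulate P? {zero}  f = refl
length-filter-tabulate P? {suc n} f with does (P? (f zero))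
... | true  = cong suc (length-filter-tabulate P? (f ∘ suc))
... | false = length-filter-tabulate P? (f ∘ suc)

does-∈? : ∀ {n} (i : Fin n) (p : Subset n) → does (i ∈? p) ≡ lookup p i
does-∈? zero    (true  ∷ p) = refl
does-∈? zero    (false ∷ p) = refl
does-∈? (suc i) (_ ∷ p)     = does-∈? i p

count-∪ : ∀ {n} (p q : Subset n) → count (lookup (p ∪ q)) + count (λ i → lookup p i ∧ lookup q i) ≡ count (lookup p) + count (lookup q)
count-∪ p q = trans (cong (_+ count (λ i → lookup p i ∧ lookup q i)) (count-cong (λ i → lookup-zipWith _∨_ i p q)))
                    (count-∨-∧ (lookup p) (lookup q))

toSubset : ∀ {n} → (Fin n → Bool) → Subset n
toSubset = tabulate

∈-toSubset⁻ : ∀ {n} {p : Fin n → Bool} {i} → i ∈ toSubset p → p i ≡ true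
∈-toSubset⁻ {p = p} {i} i∈ = trans (sym (lookup∘tabulate p i)) ([]=⇒lookup i∈)

∈-toSubset⁺ : ∀ {n} {p : Fin n → Bool} {i} → p i ≡ true → i ∈ toSubset p
∈-toSubset⁺ {p = p} {i} pi = lookup⇒[]= i _ (trans (lookup∘tabulate p i) pi)

parity-double : ∀ n → parity (n + n) ≡ 0ℙ
parity-double n = trans (+-homo-+ n n) (p+p≡0ℙ (parity n))

parity-cancelʳ : ∀ m n → parity (m + n) ≡ 0ℙ → parity n ≡ 0ℙ → parity m ≡ 0ℙ
parity-cancelʳ m n m+n-even n-even = begin
  parity m               ≡⟨ sym (+ℙ-identityʳ (parity m)) ⟩
  parity m +ℙ 0ℙ         ≡⟨ cong (parity m +ℙ_) (sym n-even) ⟩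
  parity m +ℙ parity n   ≡⟨ sym (+-homo-+ m n) ⟩
  parity (m + n)         ≡⟨ m+n-even ⟩
  0ℙ                     ∎
  where open ≡-Reasoning

parity-pred : ∀ {n p} → parity (suc n) ≡ p → parity n ≡ p ⁻¹
parity-pred {n} h = trans (sym (suc-homo-⁻¹ n)) (cong _⁻¹ h)

parity-1ℙ⇒pos : ∀ {n} → parity n ≡ 1ℙ → 0 < n
parity-1ℙ⇒pos {suc n} _ = s≤s z≤n

even-pos≤2⇒≡2 : ∀ {n} → n ≤ 2 → 0 < n → parity n ≡ 0ℙ → n ≡ 2
even-pos≤2⇒≡2 {2} _ _ _ = refl
even-pos≤2⇒≡2 {1} _ _ ()
even-pos≤2⇒≡2 {suc (suc (suc n))} (s≤s (s≤s ())) _ _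

parity-sum-even : ∀ {n} (f : Fin n → ℕ) → (∀ i → parity (f i) ≡ 0ℙ) → parity (sum f) ≡ 0ℙ
parity-sum-even {zero}  f _    = refl
parity-sum-even {suc n} f even = begin
  parity (f zero + sum (f ∘ suc))           ≡⟨ +-homo-+ (f zero) _ ⟩
  parity (f zero) +ℙ parity (sum (f ∘ suc)) ≡⟨ cong₂ _+ℙ_ (even zero) (parity-sum-even (f ∘ suc) (even ∘ suc)) ⟩
  0ℙ                                        ∎
  where open ≡-Reasoning

parity-sum-single : ∀ {n} (f : Fin n → ℕ) j → (∀ i → i ≢ j → parity (f i) ≡ 0ℙ) → parity (sum f) ≡ parity (f j)
parity-sum-single {suc n} f zero    even = begin
  parity (f zero + sum (f ∘ suc))           ≡⟨ +-homo-+ (f zero) _ ⟩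
  parity (f zero) +ℙ parity (sum (f ∘ suc)) ≡⟨ cong (parity (f zero) +ℙ_) (parity-sum-even (f ∘ suc) (λ i → even (suc i) λ ())) ⟩
  parity (f zero) +ℙ 0ℙ                     ≡⟨ +ℙ-identityʳ _ ⟩
  parity (f zero)                           ∎
  where open ≡-Reasoning
parity-sum-single {suc n} f (suc j) even = begin
  parity (f zero + sum (f ∘ suc))           ≡⟨ +-homo-+ (f zero) _ ⟩
  parity (f zero) +ℙ parity (sum (f ∘ suc)) ≡⟨ cong₂ _+ℙ_ (even zero λ ())
                                                    (parity-sum-single (f ∘ suc) j (λ i i≢j → even (suc i) (i≢j ∘ Fin.suc-injective))) ⟩
  parity (f (suc j))                        ∎
  where open ≡-Reasoning

double-injective : ∀ {m n} → m + m ≡ n + n → m ≡ n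
double-injective {m} {n} eq = trans (n≡⌊n+n/2⌋ m) (trans (cong ⌊_/2⌋ eq) (sym (n≡⌊n+n/2⌋ n)))

map⁺-on : ∀ {a b} {A : Set a} {B : Set b} {f : A → B} {xs} →
          (∀ {x y} → x ∈ₗ xs → y ∈ₗ xs → f x ≡ f y → x ≡ y) → Unique xs → Unique (List.map f xs)
map⁺-on                 _   []         = []
map⁺-on {f = f} {x ∷ xs} inj (x∉ ∷ u) =
  All.tabulate (λ fy∈ fx≡fy → let (y , y∈ , fy≡) = ∈-map⁻ f fy∈ in All.lookup x∉ y∈ (inj (here refl) (there y∈) (trans fx≡fy fy≡)))
  ∷ map⁺-on (λ x∈ y∈ → inj (there x∈) (there y∈)) u

module _ {a} {A : Set a} where

  ∈-─ : ∀ {x y : A} {ys} (x∈ys : x ∈ₗ ys) → y ∈ₗ ys → y ≢ x → y ∈ₗ (ys Any.─ x∈ys)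
  ∈-─ (here refl) (here refl) y≢x = ⊥-elim (y≢x refl)
  ∈-─ (here _)    (there y∈)  _   = y∈
  ∈-─ (there _)   (here refl) _   = here refl
  ∈-─ (there x∈)  (there y∈)  y≢x = there (∈-─ x∈ y∈ y≢x)

  unique-⊆⇒length-≤ : ∀ {xs ys : List A} → Unique xs → (∀ {x} → x ∈ₗ xs → x ∈ₗ ys) → length xs ≤ length ys
  unique-⊆⇒length-≤ {[]}     []           _   = z≤n
  unique-⊆⇒length-≤ {x ∷ xs} {ys} (x∉xs ∷ u) ⊆ys =
    subst (suc (length xs) ≤_) (sym (length-removeAt′ ys (Any.index x∈ys)))
          (s≤s (unique-⊆⇒length-≤ u λ y∈xs → ∈-─ x∈ys (⊆ys (there y∈xs)) (λ y≡x → All.lookup x∉xs y∈xs (sym y≡x))))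
    where
    x∈ys = ⊆ys (here refl)

defect-vanishes : ∀ {n m u d l c} → n + u + d ≡ m + 1 → l + n ≡ m + c → 1 ≤ c → l ≤ u → d ≡ 0
defect-vanishes {n} {m} {u} {d} {l} {c} balance forest c≥1 l≤u = n≤0⇒n≡0 (+-cancelˡ-≤ (n + u) d 0 (begin
  n + u + d   ≡⟨ balance ⟩
  m + 1       ≤⟨ +-monoʳ-≤ m c≥1 ⟩
  m + c       ≡⟨ sym forest ⟩
  l + n       ≤⟨ +-monoˡ-≤ n l≤u ⟩
  u + n       ≡⟨ +-comm u n ⟩
  n + u       ≡⟨ sym (+-identityʳ (n + u)) ⟩
  n + u + 0   ∎))
  where open ≤-Reasoning

rank-too-small : ∀ {n m k l c} → k + n ≡ m + 1 → l + n ≡ m + c → 1 ≤ c → suc l ≤ k → ⊥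
rank-too-small {n} {m} {k} {l} {c} rank forest c≥1 l<k = <-irrefl refl (begin-strict
  m + 1       ≤⟨ +-monoʳ-≤ m c≥1 ⟩
  m + c       ≡⟨ sym forest ⟩
  l + n       <⟨ +-monoˡ-< n l<k ⟩
  k + n       ≡⟨ rank ⟩
  m + 1       ∎)
  where open ≤-Reasoning

module _ where
  open import Data.Integer using (ℤ; +_; _-_; 1ℤ) renaming (_+_ to _+ℤ_)
  open import Data.Integer.Properties using (pos-+) renaming (+-injective to pos-injective)
  open import Data.Integer.Tactic.RingSolver renaming (solve-∀ to solve-∀ℤ)

  rank-ℕ⇒ℤ : ∀ {m n k} → k + n ≡ m + 1 → + m - + n +ℤ 1ℤ ≡ + k
  rank-ℕ⇒ℤ {m} {n} {k} eq = begin
    + m - + n +ℤ 1ℤ     ≡⟨ reorder (+ m) (+ n) ⟩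
    (+ m +ℤ 1ℤ) - + n   ≡⟨ cong (λ z → z - + n) (sym (pos-+ m 1)) ⟩
    + (m + 1) - + n     ≡⟨ cong (λ z → + z - + n) (sym eq) ⟩
    + (k + n) - + n     ≡⟨ cong (_- + n) (pos-+ k n) ⟩
    (+ k +ℤ + n) - + n  ≡⟨ cancel (+ k) (+ n) ⟩
    + k                 ∎
    where
    open ≡-Reasoning
    reorder : ∀ a b → a - b +ℤ 1ℤ ≡ (a +ℤ 1ℤ) - b
    reorder = solve-∀ℤ
    cancel : ∀ a b → (a +ℤ b) - b ≡ a
    cancel = solve-∀ℤ

  rank-ℤ⇒ℕ : ∀ {m n k} → + m - + n +ℤ 1ℤ ≡ + k → k + n ≡ m + 1
  rank-ℤ⇒ℕ {m} {n} {k} eq = pos-injective (begin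
    + (k + n)                 ≡⟨ pos-+ k n ⟩
    + k +ℤ + n                ≡⟨ cong (_+ℤ + n) (sym eq) ⟩
    (+ m - + n +ℤ 1ℤ) +ℤ + n  ≡⟨ cancel (+ m) (+ n) ⟩
    + m +ℤ 1ℤ                 ≡⟨ sym (pos-+ m 1) ⟩
    + (m + 1)                 ∎)
    where
    open ≡-Reasoning
    cancel : ∀ a b → (a - b +ℤ 1ℤ) +ℤ b ≡ a +ℤ 1ℤ
    cancel = solve-∀ℤ

module _ (X : Multigraph) where
  open Multigraph X
  open DecMembership (_≟_ {nV}) using () renaming (_∈?_ to _∈ᵥ?_)
  open DecMembership (_≟_ {nE}) using () renaming (_∈?_ to _∈ₑ?_)

  -- Degrees and even edge sets

  EdgeSet : Set
  EdgeSet = Fin nE → Bool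

  end₁ end₂ : Fin nE → Fin nV
  end₁ e = proj₁ (ends e)
  end₂ e = proj₂ (ends e)

  incident? : Fin nV → Fin nE → Bool
  incident? v e = v ≐ end₁ e ∨ v ≐ end₂ e

  degree : EdgeSet → Fin nV → ℕ
  degree G v = count (λ e → G e ∧ incident? v e)

  Even : EdgeSet → Set
  Even G = ∀ v → parity (degree G v) ≡ 0ℙ

  degree-remove : ∀ G {f} → G f ≡ true → ∀ v → degree G v ≡ iverson (incident? v f) + degree (G ∖ f) v
  degree-remove G {f} Gf v = trans (count-remove _ f) (cong₂ _+_ (cong (λ b → iverson (b ∧ incident? v f)) Gf) (count-cong reorder))
    where
    reorder : ∀ e → (G e ∧ incident? v e) ∧ not (e ≐ f) ≡ (G ∖ f) e ∧ incident? v e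
    reorder e = trans (Bool.∧-assoc (G e) _ _) (trans (cong (G e ∧_) (Bool.∧-comm (incident? v e) _)) (sym (Bool.∧-assoc (G e) _ _)))

  incident-end₁ : ∀ e → incident? (end₁ e) e ≡ true
  incident-end₁ e rewrite ≐-refl (end₁ e) = refl

  incident-end₂ : ∀ e → incident? (end₂ e) e ≡ true
  incident-end₂ e rewrite ≐-refl (end₂ e) = Bool.∨-zeroʳ _

  incident⇒end : ∀ {v e} → incident? v e ≡ true → v ≡ end₁ e ⊎ v ≡ end₂ e
  incident⇒end {v} {e} h with v ≟ end₁ e | v ≟ end₂ e
  ... | yes v≡end₁ | _          = inj₁ v≡end₁
  ... | no _       | yes v≡end₂ = inj₂ v≡end₂

  deg≡degree : ∀ Es v → deg X Es v ≡ degree (lookup Es) v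
  deg≡degree Es v = trans (length-filter-tabulate inEs∧incident? (λ e → e)) (count-cong λ e → cong (_∧ incident? v e) (does-∈? e Es))
    where
    inEs∧incident? : ∀ e → Dec (e ∈ Es × (v ≡ end₁ e ⊎ v ≡ end₂ e))
    inEs∧incident? e = (e ∈? Es) ×-dec ((v ≟ end₁ e) ⊎-dec (v ≟ end₂ e))

  Walk-mono : ∀ {Es Fs u v} → (∀ e → e ∈ Es → e ∈ Fs) → Walk X Es u v → Walk X Fs u v
  Walk-mono Es⊆Fs stop           = stop
  Walk-mono Es⊆Fs (step e e∈ j w) = step e (Es⊆Fs e e∈) j (Walk-mono Es⊆Fs w)

  infixr 5 _++ʷ_
  _++ʷ_ : ∀ {Es u v w} → Walk X Es u v → Walk X Es v w → Walk X Es u w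
  stop            ++ʷ q = q
  step e e∈ j p   ++ʷ q = step e e∈ j (p ++ʷ q)

  Joins-sym : ∀ {e u w} → Joins X e u w → Joins X e w u
  Joins-sym (inj₁ eq) = inj₂ eq
  Joins-sym (inj₂ eq) = inj₁ eq

  reverseʷ : ∀ {Es u v} → Walk X Es u v → Walk X Es v u
  reverseʷ stop            = stop
  reverseʷ (step e e∈ j p) = reverseʷ p ++ʷ step e e∈ (Joins-sym j) stop

  Joins⇒incident₁ : ∀ {e u w} → Joins X e u w → incident? u e ≡ true
  Joins⇒incident₁ {e} (inj₁ refl) = incident-end₁ e
  Joins⇒incident₁ {e} (inj₂ refl) = incident-end₂ e

  Joins⇒incident₂ : ∀ {e u w} → Joins X e u w → incident? w e ≡ true
  Joins⇒incident₂ = Joins⇒incident₁ ∘ Joins-sym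

  Joins⇒≢ : ∀ {e u w} → Joins X e u w → u ≢ w
  Joins⇒≢ {e} (inj₁ refl) = loopless e
  Joins⇒≢ {e} (inj₂ refl) = loopless e ∘ sym

  incident⇒Joins : ∀ {v e} → incident? v e ≡ true → ∃ λ w → Joins X e v w
  incident⇒Joins {v} {e} h with incident⇒end {v} {e} h
  ... | inj₁ refl = end₂ e , inj₁ refl
  ... | inj₂ refl = end₁ e , inj₂ refl

  Joins-incident : ∀ {e u w} {v} → Joins X e u w → incident? v e ≡ true → v ≡ u ⊎ v ≡ w
  Joins-incident (inj₁ refl) h = incident⇒end h
  Joins-incident {e} (inj₂ refl) h with incident⇒end {e = e} h
  ... | inj₁ v≡end₁ = inj₂ v≡end₁
  ... | inj₂ v≡end₂ = inj₁ v≡end₂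

  parity-degree-∖ : ∀ G {f} → G f ≡ true → ∀ v → incident? v f ≡ true →
                     parity (degree (G ∖ f) v) ≡ parity (degree G v) ⁻¹
  parity-degree-∖ G {f} Gf v vf = parity-pred {degree (G ∖ f) v} (cong parity (begin
    suc (degree (G ∖ f) v)                          ≡⟨ cong (λ b → iverson b + degree (G ∖ f) v) (sym vf) ⟩
    iverson (incident? v f) + degree (G ∖ f) v      ≡⟨ sym (degree-remove G Gf v) ⟩
    degree G v                                       ∎))
    where open ≡-Reasoning

  degree-∖ : ∀ G {f} → G f ≡ true → ∀ v → incident? v f ≡ false → degree (G ∖ f) v ≡ degree G v
  degree-∖ G {f} Gf v vf = trans (cong (λ b → iverson b + degree (G ∖ f) v) (sym vf)) (sym (degree-remove G Gf v))

  -- Leave x along any edge of G and delete it: x becomes even and the other end becomes odd,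
  -- so either it is y or the argument repeats from there in a smaller edge set.
  walk-between-odd : ∀ G {x y} → x ≢ y → parity (degree G x) ≡ 1ℙ →
                     (∀ v → v ≢ x → v ≢ y → parity (degree G v) ≡ 0ℙ) → Walk X (toSubset G) x y
  walk-between-odd G = go (count G) G ≤-refl
    where
    go : ∀ fuel G {x y} → count G ≤ fuel → x ≢ y → parity (degree G x) ≡ 1ℙ →
         (∀ v → v ≢ x → v ≢ y → parity (degree G v) ≡ 0ℙ) → Walk X (toSubset G) x y
    go fuel G {x} {y} size x≢y x-odd others-even
      with count-pos⁻ (λ e → G e ∧ incident? x e) (parity-1ℙ⇒pos x-odd)
    ... | f , Gf∧xf with Bool.∧-conicalˡ _ _ Gf∧xf | incident⇒Joins (Bool.∧-conicalʳ (G f) _ Gf∧xf)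
    ... | Gf | z , j with z ≟ y
    ...   | yes refl = step f (∈-toSubset⁺ Gf) j stop
    go zero       G size x≢y x-odd others-even | f , _ | Gf | z , j | no z≢y
      with () ← ≤-trans (≤-reflexive (sym (count-∖ G Gf))) size
    go (suc fuel) G {x} {y} size x≢y x-odd others-even | f , _ | Gf | z , j | no z≢y =
      step f (∈-toSubset⁺ Gf) j (Walk-mono (λ e e∈ → ∈-toSubset⁺ (Bool.∧-conicalˡ _ _ (∈-toSubset⁻ e∈))) rest)
      where
      z≢x : z ≢ x
      z≢x = Joins⇒≢ j ∘ sym
      rest : Walk X (toSubset (G ∖ f)) z y
      rest = go fuel (G ∖ f) (≤-pred (≤-trans (≤-reflexive (sym (count-∖ G Gf))) size)) z≢y
        (trans (parity-degree-∖ G Gf z (Joins⇒incident₂ j)) (cong _⁻¹ (others-even z z≢x z≢y)))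
        others-even′
        where
        others-even′ : ∀ v → v ≢ z → v ≢ y → parity (degree (G ∖ f) v) ≡ 0ℙ
        others-even′ v v≢z v≢y with v ≟ x | incident? v f in vf
        ... | yes refl | _     = trans (parity-degree-∖ G Gf x (Joins⇒incident₁ j)) (cong _⁻¹ x-odd)
        ... | no v≢x   | false = trans (cong parity (degree-∖ G Gf v vf)) (others-even v v≢x v≢y)
        ... | no v≢x   | true with Joins-incident j vf
        ...   | inj₁ v≡x = ⊥-elim (v≢x v≡x)
        ...   | inj₂ v≡z = ⊥-elim (v≢z v≡z)

  verticesʷ : ∀ {Es u v} → Walk X Es u v → List (Fin nV)
  verticesʷ {u = u} stop           = u ∷ []
  verticesʷ {u = u} (step _ _ _ p) = u ∷ verticesʷ p

  IsPath : ∀ {Es u v} → Walk X Es u v → Set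
  IsPath stop                   = ⊤′
  IsPath {u = u} (step _ _ _ p) = u ∉ₗ verticesʷ p × IsPath p

  start∈verticesʷ : ∀ {Es u v} (p : Walk X Es u v) → u ∈ₗ verticesʷ p
  start∈verticesʷ stop           = here refl
  start∈verticesʷ (step _ _ _ p) = here refl

  end∈verticesʷ : ∀ {Es u v} (p : Walk X Es u v) → v ∈ₗ verticesʷ p
  end∈verticesʷ stop           = here refl
  end∈verticesʷ (step _ _ _ p) = there (end∈verticesʷ p)

  path-suffix : ∀ {Es x w v} (q : Walk X Es w v) → x ∈ₗ verticesʷ q → IsPath q → Σ (Walk X Es x v) IsPath
  path-suffix stop             (here refl) _            = stop , _
  path-suffix q@(step _ _ _ _) (here refl) q-path       = q , q-path
  path-suffix (step _ _ _ r)   (there x∈r) (_ , r-path) = path-suffix r x∈r r-path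

  toPath : ∀ {Es u v} → Walk X Es u v → Σ (Walk X Es u v) IsPath
  toPath stop = stop , _
  toPath {u = u} (step e e∈ j p) with toPath p
  ... | q , q-path with u ∈ᵥ? verticesʷ q
  ...   | no  u∉q = step e e∈ j q , u∉q , q-path
  ...   | yes u∈q = path-suffix q u∈q q-path

  walkEdges⊆ : ∀ {Es u v} (p : Walk X Es u v) {f} → f ∈ₗ walkEdges X p → f ∈ Es
  walkEdges⊆ (step e e∈ _ p) (here refl) = e∈
  walkEdges⊆ (step e e∈ _ p) (there f∈p) = walkEdges⊆ p f∈p

  incident∈verticesʷ : ∀ {Es u v} (p : Walk X Es u v) {f x} → f ∈ₗ walkEdges X p → incident? x f ≡ true → x ∈ₗ verticesʷ p
  incident∈verticesʷ (step e _ j p) {x = x} (here refl) xf with Joins-incident {v = x} j xf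
  ... | inj₁ refl = here refl
  ... | inj₂ refl = there (start∈verticesʷ p)
  incident∈verticesʷ (step e _ j p) (there f∈p) xf = there (incident∈verticesʷ p f∈p xf)

  path-edges-unique : ∀ {Es u v} (p : Walk X Es u v) → IsPath p → Unique (walkEdges X p)
  path-edges-unique stop _ = []
  path-edges-unique {u = u} (step e _ j p) (u∉p , p-path) =
    All.tabulate (λ e∈p e≡ → u∉p (incident∈verticesʷ p (subst (_∈ₗ walkEdges X p) (sym e≡) e∈p) (Joins⇒incident₁ j)))
    ∷ path-edges-unique p p-path

  iverson-incident : ∀ {f x z} → Joins X f x z → ∀ v → iverson (incident? v f) ≡ iverson (v ≐ x) + iverson (v ≐ z)
  iverson-incident {f} {x} {z} j v = trans (cong iverson (incident-≐ j)) (iverson-∨-disjoint x≠z)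
    where
    x≠z : v ≐ x ≡ true → v ≐ z ≡ false
    x≠z vx = dec-false (v ≟ z) (λ v≡z → Joins⇒≢ j (trans (sym (≐-true⇒≡ vx)) v≡z))
    incident-≐ : ∀ {f x z} → Joins X f x z → incident? v f ≡ (v ≐ x ∨ v ≐ z)
    incident-≐ (inj₁ refl) = refl
    incident-≐ {f} (inj₂ refl) = Bool.∨-comm (v ≐ end₁ f) (v ≐ end₂ f)

  degreeʷ : ∀ {Es x y} → Walk X Es x y → Fin nV → ℕ
  degreeʷ p v = countₗ (incident? v) (walkEdges X p)

  path-degree : ∀ {Es x y} (p : Walk X Es x y) → IsPath p → ∀ v →
    degreeʷ p v + iverson (v ≐ x) + iverson (v ≐ y) ≡ iverson (does (v ∈ᵥ? verticesʷ p)) + iverson (does (v ∈ᵥ? verticesʷ p))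
  path-degree {x = x} stop _ v = cong (λ b → iverson b + iverson b) (sym (Bool.∨-identityʳ (v ≐ x)))
  path-degree {x = x} {y} (step {w = z} f _ j p) (x∉p , p-path) v = begin
    iverson (incident? v f) + degreeʷ p v + ix + iy ≡⟨ cong (λ n → n + degreeʷ p v + ix + iy) (iverson-incident j v) ⟩
    ix + iz + degreeʷ p v + ix + iy                   ≡⟨ regroup ix iz (degreeʷ p v) iy ⟩
    (ix + ix) + (degreeʷ p v + iz + iy)               ≡⟨ cong ((ix + ix) +_) (path-degree p p-path v) ⟩
    (ix + ix) + (ip + ip)                             ≡⟨ interchange ix ip ⟩
    (ix + ip) + (ix + ip)                             ≡⟨ cong (λ n → n + n) (sym (iverson-∨-disjoint x∉p′)) ⟩
    iverson (v ≐ x ∨ does (v ∈ᵥ? verticesʷ p)) + iverson (v ≐ x ∨ does (v ∈ᵥ? verticesʷ p)) ∎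
    where
    open ≡-Reasoning
    ix = iverson (v ≐ x)
    iy = iverson (v ≐ y)
    iz = iverson (v ≐ z)
    ip = iverson (does (v ∈ᵥ? verticesʷ p))
    regroup : ∀ a b c d → a + b + c + a + d ≡ (a + a) + (c + b + d)
    regroup = solve-∀
    interchange : ∀ a b → (a + a) + (b + b) ≡ (a + b) + (a + b)
    interchange = solve-∀
    x∉p′ : v ≐ x ≡ true → does (v ∈ᵥ? verticesʷ p) ≡ false
    x∉p′ vx = dec-false (v ∈ᵥ? verticesʷ p) (subst (_∉ₗ verticesʷ p) (sym (≐-true⇒≡ vx)) x∉p)

  walk-degree-parity : ∀ {Es x y} (p : Walk X Es x y) → ∀ v →
    parity (degreeʷ p v + iverson (v ≐ x) + iverson (v ≐ y)) ≡ 0ℙ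
  walk-degree-parity {x = x} stop v = parity-double (iverson (v ≐ x))
  walk-degree-parity {x = x} {y} (step {w = z} f _ j p) v = begin
    parity (iverson (incident? v f) + degreeʷ p v + ix + iy) ≡⟨ cong (λ n → parity (n + degreeʷ p v + ix + iy)) (iverson-incident j v) ⟩
    parity (ix + iz + degreeʷ p v + ix + iy)                   ≡⟨ cong parity (regroup ix iz (degreeʷ p v) iy) ⟩
    parity ((ix + ix) + (degreeʷ p v + iz + iy))               ≡⟨ +-homo-+ (ix + ix) _ ⟩
    parity (ix + ix) +ℙ parity (degreeʷ p v + iz + iy)         ≡⟨ cong₂ _+ℙ_ (parity-double ix) (walk-degree-parity p v) ⟩
    0ℙ                                                        ∎
    where
    open ≡-Reasoning
    ix = iverson (v ≐ x)
    iy = iverson (v ≐ y)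
    iz = iverson (v ≐ z)
    regroup : ∀ a b c d → a + b + c + a + d ≡ (a + a) + (c + b + d)
    regroup = solve-∀

  degree-split : ∀ F C → C ⊆ᵇ F → ∀ v → degree F v ≡ degree (F − C) v + degree C v
  degree-split F C C⊆F v = trans (count-split (λ f → F f ∧ incident? v f) C) (cong₂ _+_ (count-cong outside) (count-cong inside))
    where
    outside : ∀ f → (F f ∧ incident? v f) ∧ not (C f) ≡ (F f ∧ not (C f)) ∧ incident? v f
    outside f = trans (Bool.∧-assoc (F f) _ _) (trans (cong (F f ∧_) (Bool.∧-comm (incident? v f) _)) (sym (Bool.∧-assoc (F f) _ _)))
    inside : ∀ f → (F f ∧ incident? v f) ∧ C f ≡ C f ∧ incident? v f
    inside f with C f in Cf
    ... | false = Bool.∧-zeroʳ _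
    ... | true  = trans (Bool.∧-identityʳ _) (cong (_∧ incident? v f) (C⊆F f Cf))

  even-− : ∀ F C → C ⊆ᵇ F → Even F → Even C → Even (F − C)
  even-− F C C⊆F F-even C-even v =
    parity-cancelʳ (degree (F − C) v) (degree C v) (trans (cong parity (sym (degree-split F C C⊆F v))) (F-even v)) (C-even v)

  even-xor : ∀ A B → Even A → Even B → Even (λ f → A f xor B f)
  even-xor A B A-even B-even v =
    parity-cancelʳ (degree (λ f → A f xor B f) v) (d + d) (trans (cong parity degrees) sum-even) (parity-double d)
    where
    A∧B = λ f → A f ∧ B f
    d = degree A∧B v
    degrees : degree (λ f → A f xor B f) v + (d + d) ≡ degree A v + degree B v
    degrees = trans (cong₂ (λ m n → m + (n + n)) (count-cong (λ f → Bool.∧-distribʳ-xor (incident? v f) (A f) (B f))) (count-cong ∧-distrib))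
                    (count-xor (λ f → A f ∧ incident? v f) (λ f → B f ∧ incident? v f))
      where
      ∧-distrib : ∀ f → A∧B f ∧ incident? v f ≡ (A f ∧ incident? v f) ∧ (B f ∧ incident? v f)
      ∧-distrib f with incident? v f
      ... | true  = trans (Bool.∧-identityʳ _) (cong₂ _∧_ (sym (Bool.∧-identityʳ (A f))) (sym (Bool.∧-identityʳ (B f))))
      ... | false = trans (Bool.∧-zeroʳ _) (sym (cong₂ _∧_ (Bool.∧-zeroʳ (A f)) (Bool.∧-zeroʳ (B f))))
    sum-even : parity (degree A v + degree B v) ≡ 0ℙ
    sum-even = trans (+-homo-+ (degree A v) _) (cong₂ _+ℙ_ (A-even v) (B-even v))

  Sub-≟ : (H K : Sub X) → Dec (H ≡ K)
  Sub-≟ = Product.≡-dec (Vec.≡-dec Bool._≟_) (Vec.≡-dec Bool._≟_)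

  record CycleWithin (F : EdgeSet) (e : Fin nE) : Set where
    field
      cycle   : Sub X
      isCycle : IsCycle X cycle
      ∋e      : e ∈ edges X cycle
      ⊆F      : ∀ f → f ∈ edges X cycle → F f ≡ true

  degree-lookup-toSubset : ∀ G v → degree (lookup (toSubset G)) v ≡ degree G v
  degree-lookup-toSubset G v = count-cong (λ f → cong (_∧ incident? v f) (lookup∘tabulate G f))

  path-prefix : ∀ {Es Fs x y v} (p : Walk X Es x y) → (∀ f → f ∈ₗ walkEdges X p → f ∈ Fs) →
                v ∈ₗ verticesʷ p → Walk X Fs x v
  path-prefix stop             _   (here refl) = stop
  path-prefix (step _ _ _ _)   _   (here refl) = stop
  path-prefix (step e _ j p)   ⊆Fs (there v∈p) = step e (⊆Fs e (here refl)) j (path-prefix p (λ f → ⊆Fs f ∘ there) v∈p)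

  module ClosePath (G : EdgeSet) {e u w} (j : Joins X e u w) (P : Walk X (toSubset G) w u) (P-path : IsPath P) where
    cycleEdges : List (Fin nE)
    cycleEdges = e ∷ walkEdges X P

    cycleEdges-unique : G e ≡ false → Unique cycleEdges
    cycleEdges-unique Ge = ¬Any⇒All¬ _ e∉P ∷ path-edges-unique P P-path
      where
      e∉P : e ∉ₗ walkEdges X P
      e∉P e∈P with () ← trans (sym (∈-toSubset⁻ (walkEdges⊆ P e∈P))) Ge

    C : Sub X
    C = toSubset (λ v → does (v ∈ᵥ? verticesʷ P)) , toSubset (λ f → does (f ∈ₑ? cycleEdges))

    ∈C⁺ : ∀ {v} → v ∈ₗ verticesʷ P → v ∈ verts X C
    ∈C⁺ {v} v∈P = ∈-toSubset⁺ (dec-true (v ∈ᵥ? verticesʷ P) v∈P)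

    ∈C⁻ : ∀ {f} → f ∈ edges X C → f ∈ₗ cycleEdges
    ∈C⁻ {f} f∈C = from-does {a? = f ∈ₑ? cycleEdges} (∈-toSubset⁻ f∈C)

    isSubgraph : IsSubgraph X C
    isSubgraph f f∈C = endpoint (incident-end₁ f) , endpoint (incident-end₂ f)
      where
      endpoint : ∀ {v} → incident? v f ≡ true → v ∈ verts X C
      endpoint {v} vf with ∈C⁻ f∈C
      ... | there f∈P = ∈C⁺ (incident∈verticesʷ P f∈P vf)
      ... | here refl with Joins-incident {v = v} j vf
      ...   | inj₁ refl = ∈C⁺ (end∈verticesʷ P)
      ...   | inj₂ refl = ∈C⁺ (start∈verticesʷ P)

    prefix : ∀ {v} → v ∈ verts X C → Walk X (edges X C) w v
    prefix {v} v∈C = path-prefix P (λ f f∈P → ∈-toSubset⁺ (dec-true (f ∈ₑ? cycleEdges) (there f∈P)))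
                                   (from-does {a? = v ∈ᵥ? verticesʷ P} (∈-toSubset⁻ v∈C))

    isConnected : SubConnected X C
    isConnected = (w , ∈C⁺ (start∈verticesʷ P)) , λ x y x∈C y∈C → reverseʷ (prefix x∈C) ++ʷ prefix y∈C

    degree-two : G e ≡ false → ∀ v → v ∈ verts X C → deg X (edges X C) v ≡ 2
    degree-two Ge v v∈C = begin
      deg X (edges X C) v                                   ≡⟨ deg≡degree (edges X C) v ⟩
      degree (lookup (edges X C)) v                         ≡⟨ degree-lookup-toSubset _ v ⟩
      count (λ f → does (f ∈ₑ? cycleEdges) ∧ incident? v f) ≡⟨ count-unique-list (cycleEdges-unique Ge) (incident? v) ⟩
      iverson (incident? v e) + degreeʷ P v                 ≡⟨ cong (_+ degreeʷ P v) (iverson-incident j v) ⟩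
      iverson (v ≐ u) + iverson (v ≐ w) + degreeʷ P v       ≡⟨ reorder (iverson (v ≐ u)) (iverson (v ≐ w)) (degreeʷ P v) ⟩
      degreeʷ P v + iverson (v ≐ w) + iverson (v ≐ u)       ≡⟨ path-degree P P-path v ⟩
      iverson onP + iverson onP                             ≡⟨ cong (λ b → iverson b + iverson b) (∈-toSubset⁻ v∈C) ⟩
      2                                                     ∎
      where
      open ≡-Reasoning
      onP = does (v ∈ᵥ? verticesʷ P)
      reorder : ∀ a b c → a + b + c ≡ c + b + a
      reorder = solve-∀

    isCycle : G e ≡ false → IsCycle X C
    isCycle Ge = isSubgraph , isConnected , degree-two Ge

    ∋e : e ∈ edges X C
    ∋e = ∈-toSubset⁺ (dec-true (e ∈ₑ? cycleEdges) (here refl))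

    ⊆G+e : ∀ f → f ∈ edges X C → f ≡ e ⊎ G f ≡ true
    ⊆G+e f f∈C with ∈C⁻ f∈C
    ... | here f≡e  = inj₁ f≡e
    ... | there f∈P = inj₂ (∈-toSubset⁻ (walkEdges⊆ P f∈P))

  closingCycle : ∀ G {e u w} → Joins X e u w → Walk X (toSubset G) w u → Sub X
  closingCycle G j P = ClosePath.C G j (proj₁ (toPath P)) (proj₂ (toPath P))

  cycle-closing : ∀ G {e u w} (j : Joins X e u w) → G e ≡ false → (P : Walk X (toSubset G) w u) →
                  CycleWithin (λ f → f ≐ e ∨ G f) e
  cycle-closing G j Ge P = record { cycle = closingCycle G j P ; isCycle = isCycle Ge ; ∋e = ∋e ; ⊆F = ⊆F }
    where
    open ClosePath G j (proj₁ (toPath P)) (proj₂ (toPath P))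
    ⊆F : ∀ f → f ∈ edges X C → (f ≐ _ ∨ G f) ≡ true
    ⊆F f f∈C with ⊆G+e f f∈C
    ... | inj₁ refl = cong (_∨ G f) (≐-refl f)
    ... | inj₂ Gf   = trans (cong (f ≐ _ ∨_) Gf) (Bool.∨-zeroʳ _)

  CycleWithin-mono : ∀ {F F′ e} → F ⊆ᵇ F′ → CycleWithin F e → CycleWithin F′ e
  CycleWithin-mono F⊆F′ C = record { CycleWithin C ; ⊆F = λ f f∈C → F⊆F′ f (CycleWithin.⊆F C f f∈C) }

  -- Opaque because only the specification is ever needed: unfolding the cycle it builds makes
  -- type checking of its users blow up.
  opaque
    cycle-through : ∀ F → Even F → ∀ {e} → F e ≡ true → CycleWithin F e
    cycle-through F F-even {e} Fe = CycleWithin-mono ⊆F (cycle-closing G (inj₁ refl) Ge walk)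
      where
      G : EdgeSet
      G = F ∖ e
      Ge : G e ≡ false
      Ge = trans (cong (λ b → F e ∧ not b) (≐-refl e)) (Bool.∧-zeroʳ (F e))
      walk : Walk X (toSubset G) (end₂ e) (end₁ e)
      walk = walk-between-odd G (loopless e ∘ sym)
        (trans (parity-degree-∖ F Fe (end₂ e) (incident-end₂ e)) (cong _⁻¹ (F-even (end₂ e))))
        (λ v v≢end₂ v≢end₁ → trans (cong parity (degree-∖ F Fe v (Bool.¬-not (not-incident v≢end₁ v≢end₂)))) (F-even v))
        where
        not-incident : ∀ {v} → v ≢ end₁ e → v ≢ end₂ e → incident? v e ≢ true
        not-incident v≢end₁ v≢end₂ ve with incident⇒end {e = e} ve
        ... | inj₁ v≡end₁ = v≢end₁ v≡end₁
        ... | inj₂ v≡end₂ = v≢end₂ v≡end₂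
      ⊆F : (λ f → f ≐ e ∨ G f) ⊆ᵇ F
      ⊆F f h with f ≟ e
      ... | yes refl = Fe
      ... | no _     = Bool.∧-conicalˡ _ _ h

  subgraph-incident∈ : ∀ {H} → IsSubgraph X H → ∀ {v f} → f ∈ edges X H → incident? v f ≡ true → v ∈ verts X H
  subgraph-incident∈ H-sub {v} {f} f∈H vf with incident⇒end {v} {f} vf
  ... | inj₁ refl = proj₁ (H-sub f f∈H)
  ... | inj₂ refl = proj₂ (H-sub f f∈H)

  module _ {C : Sub X} (C-cycle : IsCycle X C) where
    private
      Cₑ = lookup (edges X C)
      C-sub = proj₁ C-cycle
      C-nonempty = proj₁ (proj₁ (proj₂ C-cycle))
      C-walk = proj₂ (proj₁ (proj₂ C-cycle))

    cycle-degree∈ : ∀ {v} → v ∈ verts X C → degree Cₑ v ≡ 2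
    cycle-degree∈ {v} v∈C = trans (sym (deg≡degree (edges X C) v)) (proj₂ (proj₂ C-cycle) v v∈C)

    cycle-degree∉ : ∀ {v} → v ∉ verts X C → degree Cₑ v ≡ 0
    cycle-degree∉ {v} v∉C = count-none λ f → Bool.¬-not λ Cf∧vf →
      v∉C (subgraph-incident∈ C-sub (lookup⇒[]= f _ (Bool.∧-conicalˡ _ _ Cf∧vf)) (Bool.∧-conicalʳ (Cₑ f) _ Cf∧vf))

    cycle-even : Even Cₑ
    cycle-even v with v ∈? verts X C
    ... | yes v∈C = cong parity (cycle-degree∈ v∈C)
    ... | no  v∉C = cong parity (cycle-degree∉ v∉C)

    cycle-vertex-edge : ∀ {v} → v ∈ verts X C → ∃ λ f → f ∈ edges X C × incident? v f ≡ true
    cycle-vertex-edge {v} v∈C with count-pos⁻ (λ f → Cₑ f ∧ incident? v f) (subst (0 <_) (sym (cycle-degree∈ v∈C)) (s≤s z≤n))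
    ... | f , Cf∧vf = f , lookup⇒[]= f _ (Bool.∧-conicalˡ _ _ Cf∧vf) , Bool.∧-conicalʳ (Cₑ f) _ Cf∧vf

    cycle-edge : ∃ λ f → f ∈ edges X C
    cycle-edge = let (f , f∈C , _) = cycle-vertex-edge (proj₂ C-nonempty) in f , f∈C

    -- An even set S inside a cycle has degree 0 or 2 at every vertex, and degree 2 at a vertex
    -- forces S to contain both cycle edges there; connectivity spreads this around the cycle.
    cycle-minimal : ∀ S → S ⊆ᵇ Cₑ → Even S → ∀ {f₀} → S f₀ ≡ true → Cₑ ⊆ᵇ S
    cycle-minimal S S⊆C S-even {f₀} Sf₀ g Cg =
      saturated (end₁ g) (spread (C-walk _ _ (end-in f₀ (S⊆C f₀ Sf₀)) (end-in g Cg)) (f₀ , Sf₀ , incident-end₁ f₀))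
                g Cg (incident-end₁ g)
      where
      end-in : ∀ f → Cₑ f ≡ true → end₁ f ∈ verts X C
      end-in f Cf = proj₁ (C-sub f (lookup⇒[]= f _ Cf))
      Touches : Fin nV → Set
      Touches v = ∃ λ f → S f ≡ true × incident? v f ≡ true
      saturated : ∀ v → Touches v → ∀ g → Cₑ g ≡ true → incident? v g ≡ true → S g ≡ true
      saturated v (f , Sf , vf) g Cg vg =
        Bool.∧-conicalˡ _ _ (count-mono-reflects-≡ S∧v⊆C∧v degree-S≡degree-C g (trans (cong (_∧ _) Cg) vg))
        where
        v∈C : v ∈ verts X C
        v∈C = subgraph-incident∈ C-sub (lookup⇒[]= f _ (S⊆C f Sf)) vf
        S∧v⊆C∧v : (λ h → S h ∧ incident? v h) ⊆ᵇ (λ h → Cₑ h ∧ incident? v h)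
        S∧v⊆C∧v h Sh∧vh = trans (cong (_∧ _) (S⊆C h (Bool.∧-conicalˡ _ _ Sh∧vh))) (Bool.∧-conicalʳ (S h) _ Sh∧vh)
        degree-S≡degree-C : degree S v ≡ degree Cₑ v
        degree-S≡degree-C = trans (even-pos≤2⇒≡2 (subst (degree S v ≤_) (cycle-degree∈ v∈C) (count-mono S∧v⊆C∧v))
                                                 (count-pos⁺ (λ h → S h ∧ incident? v h) (trans (cong (_∧ incident? v f) Sf) vf))
                                                 (S-even v))
                                  (sym (cycle-degree∈ v∈C))
      spread : ∀ {x y} → Walk X (edges X C) x y → Touches x → Touches y
      spread stop                t = t
      spread {x} (step g g∈C j rest) t = spread rest (g , saturated x t g ([]=⇒lookup g∈C) (Joins⇒incident₁ j) , Joins⇒incident₂ j)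

  cycle-⊆⇒≡ : ∀ {C D} → IsCycle X C → IsCycle X D → edges X C ⊆ edges X D → C ≡ D
  cycle-⊆⇒≡ {C} {D} C-cycle D-cycle C⊆D =
    cong₂ _,_ (⊆-antisym (vertices⊆ C-cycle D-cycle C⊆D) (vertices⊆ D-cycle C-cycle D⊆C)) (⊆-antisym C⊆D D⊆C)
    where
    D⊆C : edges X D ⊆ edges X C
    D⊆C {g} g∈D = let (f , f∈C) = cycle-edge C-cycle in
      lookup⇒[]= g _ (cycle-minimal D-cycle (lookup (edges X C)) (λ h Ch → []=⇒lookup (C⊆D (lookup⇒[]= h _ Ch)))
                                    (cycle-even C-cycle) ([]=⇒lookup f∈C) g ([]=⇒lookup g∈D))
    vertices⊆ : ∀ {C D} → IsCycle X C → IsCycle X D → edges X C ⊆ edges X D → verts X C ⊆ verts X D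
    vertices⊆ C-cycle D-cycle C⊆D v∈C = let (f , f∈C , vf) = cycle-vertex-edge C-cycle v∈C in
      subgraph-incident∈ (proj₁ D-cycle) (C⊆D f∈C) vf

  eulerian⇒even : Eulerian X → Even (λ _ → true)
  eulerian⇒even (x , t , t-unique , t-all) v =
    parity-cancelʳ (degree (λ _ → true) v) (ix + ix) (trans (cong parity along-t) (walk-degree-parity t v)) (parity-double ix)
    where
    ix = iverson (v ≐ x)
    along-t : degree (λ _ → true) v + (ix + ix) ≡ degreeʷ t v + ix + ix
    along-t = trans (cong (_+ (ix + ix)) (trans (count-cong (λ f → cong (_∧ incident? v f) (sym (dec-true (f ∈ₑ? walkEdges X t) (t-all f)))))
                                                (count-unique-list t-unique (incident? v))))
                    (sym (+-assoc (degreeʷ t v) ix ix))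

  -- Decompositions into cycles; conditions (1) to (4)

  record Decomposition (F : EdgeSet) : Set where
    field
      cycles   : List (Sub X)
      unique   : Unique cycles
      isCycle  : ∀ {C} → C ∈ₗ cycles → IsCycle X C
      ⊆F       : ∀ {C} → C ∈ₗ cycles → ∀ f → f ∈ edges X C → F f ≡ true
      cover    : ∀ e → F e ≡ true → ∃ λ C → C ∈ₗ cycles × e ∈ edges X C
      disjoint : ∀ {C D e} → C ∈ₗ cycles → D ∈ₗ cycles → e ∈ edges X C → e ∈ edges X D → C ≡ D

  empty-decomposition : ∀ {F} → (∀ e → F e ≡ false) → Decomposition F
  empty-decomposition none = record
    { cycles = [] ; unique = [] ; isCycle = λ () ; ⊆F = λ () ; disjoint = λ ()
    ; cover = λ e Fe → ⊥-elim (Bool.not-¬ Fe (none e)) }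

  decomposition-∷ : ∀ {F e} (C : CycleWithin F e) →
                    Decomposition (F − lookup (edges X (CycleWithin.cycle C))) → Decomposition F
  decomposition-∷ {F} C D = record
    { cycles   = C′ ∷ cycles
    ; unique   = All.tabulate (λ D∈ C′≡D → avoids-C′ D∈ f₀ (subst (λ H → f₀ ∈ edges X H) C′≡D f₀∈C′) f₀∈C′) ∷ unique
    ; isCycle  = λ { (here refl) → CycleWithin.isCycle C ; (there D∈) → isCycle D∈ }
    ; ⊆F       = λ { (here refl) → CycleWithin.⊆F C ; (there D∈) f f∈D → Bool.∧-conicalˡ _ _ (⊆F D∈ f f∈D) }
    ; cover    = cover′
    ; disjoint = disjoint′
    }
    where
    open Decomposition D
    C′ = CycleWithin.cycle C
    f₀ = proj₁ (cycle-edge (CycleWithin.isCycle C))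
    f₀∈C′ = proj₂ (cycle-edge (CycleWithin.isCycle C))
    avoids-C′ : ∀ {H} → H ∈ₗ cycles → ∀ f → f ∈ edges X H → f ∈ edges X C′ → ⊥
    avoids-C′ H∈ f f∈H f∈C′ = Bool.not-¬ ([]=⇒lookup f∈C′) (Bool.not-injective (Bool.∧-conicalʳ (F f) _ (⊆F H∈ f f∈H)))
    cover′ : ∀ e → F e ≡ true → ∃ λ H → H ∈ₗ C′ ∷ cycles × e ∈ edges X H
    cover′ e Fe with lookup (edges X C′) e in C′e
    ... | true  = C′ , here refl , lookup⇒[]= e _ C′e
    ... | false = let (H , H∈ , e∈H) = cover e (trans (cong (λ b → F e ∧ not b) C′e) (trans (Bool.∧-identityʳ (F e)) Fe))
                  in H , there H∈ , e∈H
    disjoint′ : ∀ {H K e} → H ∈ₗ C′ ∷ cycles → K ∈ₗ C′ ∷ cycles → e ∈ edges X H → e ∈ edges X K → H ≡ K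
    disjoint′ (here refl) (here refl) _   _   = refl
    disjoint′ (here refl) (there K∈)  e∈H e∈K = ⊥-elim (avoids-C′ K∈ _ e∈K e∈H)
    disjoint′ (there H∈)  (here refl) e∈H e∈K = ⊥-elim (avoids-C′ H∈ _ e∈H e∈K)
    disjoint′ (there H∈)  (there K∈)  e∈H e∈K = disjoint H∈ K∈ e∈H e∈K

  decompose : ∀ F → Even F → Decomposition F
  decompose F = go (count F) F ≤-refl
    where
    go : ∀ fuel F → count F ≤ fuel → Even F → Decomposition F
    go fuel F size F-even with any? (λ e → F e Bool.≟ true)
    ... | no none = empty-decomposition (λ e → Bool.¬-not (λ Fe → none (e , Fe)))
    ... | yes (e , Fe) = decomposition-∷ C (go′ fuel size)
      where
      C = cycle-through F F-even Fe
      Cₑ = lookup (edges X (CycleWithin.cycle C))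
      Cₑ⊆F : Cₑ ⊆ᵇ F
      Cₑ⊆F f Cf = CycleWithin.⊆F C f (lookup⇒[]= f _ Cf)
      smaller : count (F − Cₑ) < count F
      smaller = count-−< F Cₑ Fe ([]=⇒lookup (CycleWithin.∋e C))
      go′ : ∀ fuel → count F ≤ fuel → Decomposition (F − Cₑ)
      go′ zero       size with () ← <-≤-trans smaller size
      go′ (suc fuel) size = go fuel (F − Cₑ) (≤-pred (<-≤-trans smaller size))
                               (even-− F Cₑ Cₑ⊆F F-even (cycle-even (CycleWithin.isCycle C)))

  decomposition⇒partition : (D : Decomposition (λ _ → true)) → IsPartition X (_∈ₗ Decomposition.cycles D)
  decomposition⇒partition D = (λ _ → isCycle) , λ e → let (H , H∈ , e∈H) = cover e refl in
    H , H∈ , e∈H , λ K K∈ e∈K → disjoint K∈ H∈ e∈K e∈H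
    where open Decomposition D

  decomposition-through : Eulerian X → ∀ {C} → IsCycle X C →
                          Σ (Decomposition (λ _ → true)) λ D → C ∈ₗ Decomposition.cycles D
  decomposition-through eu {C} C-cycle = decomposition-∷ C′ (decompose _ rest-even) , here refl
    where
    C′ : CycleWithin (λ _ → true) (proj₁ (cycle-edge C-cycle))
    C′ = record { cycle = C ; isCycle = C-cycle ; ∋e = proj₂ (cycle-edge C-cycle) ; ⊆F = λ _ _ → refl }
    rest-even = even-− (λ _ → true) (lookup (edges X C)) (λ _ _ → refl) (eulerian⇒even eu) (cycle-even C-cycle)

  cycle-through-edge : Eulerian X → ∀ e → ∃ λ C → IsCycle X C × e ∈ edges X C
  cycle-through-edge eu e = let C = cycle-through (λ _ → true) (eulerian⇒even eu) {e} refl in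
    CycleWithin.cycle C , CycleWithin.isCycle C , CycleWithin.∋e C

  cond1⇒sharing-cycles-≡ : Cond1 X → ∀ {H K e} → IsCycle X H → IsCycle X K → e ∈ edges X H → e ∈ edges X K → H ≡ K
  cond1⇒sharing-cycles-≡ c1 {H} {K} {e} H-cycle K-cycle e∈H e∈K with Sub-≟ H K
  ... | yes H≡K = H≡K
  ... | no  H≢K = ⊥-elim (c1 H K H-cycle K-cycle H≢K e e∈H e∈K)

  cond1⇒cond2 : Eulerian X → Cond1 X → Cond2 X
  cond1⇒cond2 eu c1 e = let (H , H-cycle , e∈H) = cycle-through-edge eu e in
    H , H-cycle , e∈H , λ K K-cycle e∈K → cond1⇒sharing-cycles-≡ c1 K-cycle H-cycle e∈K e∈H

  cond2⇒cond1 : Cond2 X → Cond1 X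
  cond2⇒cond1 c2 H K H-cycle K-cycle H≢K e e∈H e∈K =
    let (_ , _ , _ , unique) = c2 e in H≢K (trans (unique H H-cycle e∈H) (sym (unique K K-cycle e∈K)))

  cond1⇒cond3 : Eulerian X → Cond1 X → Cond3 X
  cond1⇒cond3 eu c1 = (λ _ H-cycle → H-cycle) , cond1⇒cond2 eu c1

  cond3⇒cond1 : Cond3 X → Cond1 X
  cond3⇒cond1 = cond2⇒cond1 ∘ proj₂

  cond1⇒cond4 : Eulerian X → Cond1 X → Cond4 X
  cond1⇒cond4 eu c1 = IsCycle X , cond1⇒cond3 eu c1 , λ B B-partition H → mk⇔ (proj₁ B-partition H) (B∋ B B-partition)
    where
    B∋ : ∀ B → IsPartition X B → ∀ {H} → IsCycle X H → B H
    B∋ B (B-cycles , B-cover) {H} H-cycle =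
      let (e , e∈H) = cycle-edge H-cycle
          (K , BK , e∈K , _) = B-cover e
      in subst B (cond1⇒sharing-cycles-≡ c1 (B-cycles K BK) H-cycle e∈K e∈H) BK

  cond4⇒cond1 : Eulerian X → Cond4 X → Cond1 X
  cond4⇒cond1 eu (A , (_ , A-cover) , A-unique) H K H-cycle K-cycle H≢K e e∈H e∈K =
    let (_ , _ , _ , unique) = A-cover e in H≢K (trans (unique H (∈A H-cycle) e∈H) (sym (unique K (∈A K-cycle) e∈K)))
    where
    ∈A : ∀ {C} → IsCycle X C → A C
    ∈A {C} C-cycle = let (D , C∈D) = decomposition-through eu C-cycle in
      Equivalence.to (A-unique _ (decomposition⇒partition D) C) C∈D

  handshake : ∀ S → sum (degree S) ≡ count S + count S
  handshake S = begin
    sum (degree S)                                              ≡⟨ sum-cong-≗ {nV} (λ v → count≡sum (λ f → S f ∧ incident? v f)) ⟩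
    sum (λ v → sum (λ f → iverson (S f ∧ incident? v f)))        ≡⟨ ∑-comm (λ v f → iverson (S f ∧ incident? v f)) ⟩
    sum (λ f → sum (λ v → iverson (S f ∧ incident? v f)))        ≡⟨ sum-cong-≗ {nE} edge-contribution ⟩
    sum (λ f → iverson (S f) + iverson (S f))                    ≡⟨ ∑-distrib-+ (iverson ∘ S) (iverson ∘ S) ⟩
    sum (iverson ∘ S) + sum (iverson ∘ S)                        ≡⟨ cong (λ n → n + n) (sym (count≡sum S)) ⟩
    count S + count S                                            ∎
    where
    open ≡-Reasoning
    edge-contribution : ∀ f → sum (λ v → iverson (S f ∧ incident? v f)) ≡ iverson (S f) + iverson (S f)
    edge-contribution f with S f
    ... | true  = trans (sym (count≡sum (λ v → incident? v f))) (count-pair (loopless f))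
    ... | false = trans (sym (count≡sum {nV} (λ _ → false))) (count-none {nV} (λ _ → refl))

  cycle-size : ∀ {C} → IsCycle X C → count (lookup (verts X C)) ≡ count (lookup (edges X C))
  cycle-size {C} C-cycle = double-injective (begin
    count Cᵥ + count Cᵥ                                  ≡⟨ cong (λ n → n + n) (count≡sum Cᵥ) ⟩
    sum (iverson ∘ Cᵥ) + sum (iverson ∘ Cᵥ)              ≡⟨ sym (∑-distrib-+ (iverson ∘ Cᵥ) (iverson ∘ Cᵥ)) ⟩
    sum (λ v → iverson (Cᵥ v) + iverson (Cᵥ v))          ≡⟨ sum-cong-≗ {nV} twice-membership ⟩
    sum (degree Cₑ)                                      ≡⟨ handshake Cₑ ⟩
    count Cₑ + count Cₑ                                  ∎)
    where
    open ≡-Reasoning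
    Cᵥ = lookup (verts X C)
    Cₑ = lookup (edges X C)
    twice-membership : ∀ v → iverson (Cᵥ v) + iverson (Cᵥ v) ≡ degree Cₑ v
    twice-membership v with Cᵥ v in Cv
    ... | true  = sym (cycle-degree∈ C-cycle (lookup⇒[]= v _ Cv))
    ... | false = sym (cycle-degree∉ C-cycle (λ v∈C → Bool.not-¬ ([]=⇒lookup v∈C) Cv))

  -- Members of 𝒮 are cacti: condition (5)

  SharesOnly : Sub X → Sub X → Fin nV → Set
  SharesOnly H₁ H₂ w = ∀ u → (u ∈ verts X H₁ × u ∈ verts X H₂) ⇔ (u ≡ w)

  module _ {H₁ H₂ C w} (H₁-sub : IsSubgraph X H₁) (H₂-sub : IsSubgraph X H₂) (shares : SharesOnly H₁ H₂ w)
           (C-cycle : IsCycle X C) (C⊆H₁∪H₂ : edges X C ⊆ edges X H₁ ∪ edges X H₂) where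
    private
      Cₑ = lookup (edges X C)
      H₁ₑ = lookup (edges X H₁)
      C₁ : EdgeSet
      C₁ f = Cₑ f ∧ H₁ₑ f

      away-from-w : ∀ v → v ≢ w → parity (degree C₁ v) ≡ 0ℙ
      away-from-w v v≢w with v ∈? verts X H₁
      ... | yes v∈H₁ = trans (cong parity (count-cong same-edges)) (cycle-even C-cycle v)
        where
        same-edges : ∀ f → C₁ f ∧ incident? v f ≡ Cₑ f ∧ incident? v f
        same-edges f with Cₑ f in Cf | incident? v f in vf
        ... | false | _     = refl
        ... | true  | false = Bool.∧-zeroʳ _
        ... | true  | true with x∈p∪q⁻ (edges X H₁) (edges X H₂) (C⊆H₁∪H₂ (lookup⇒[]= f _ Cf))
        ...   | inj₁ f∈H₁ = cong (_∧ true) ([]=⇒lookup f∈H₁)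
        ...   | inj₂ f∈H₂ = ⊥-elim (v≢w (Equivalence.to (shares v) (v∈H₁ , subgraph-incident∈ H₂-sub f∈H₂ vf)))
      ... | no v∉H₁ = cong parity (count-none λ f → Bool.¬-not λ C₁f∧vf →
              v∉H₁ (subgraph-incident∈ H₁-sub (lookup⇒[]= f _ (Bool.∧-conicalʳ (Cₑ f) _ (Bool.∧-conicalˡ _ _ C₁f∧vf)))
                                               (Bool.∧-conicalʳ (C₁ f) _ C₁f∧vf)))

    -- Away from w every edge of C at a vertex of H₁ lies in H₁; at w the handshake lemma decides.
    cycle∩side-even : Even C₁
    cycle∩side-even v with v ≟ w
    ... | no  v≢w  = away-from-w v v≢w
    ... | yes refl = trans (sym (parity-sum-single (degree C₁) v away-from-w))
                           (trans (cong parity (handshake C₁)) (parity-double (count C₁)))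

    cycle-in-one-side : edges X C ⊆ edges X H₁ ⊎ edges X C ⊆ edges X H₂
    cycle-in-one-side with any? (λ f → C₁ f Bool.≟ true)
    ... | yes (f₀ , C₁f₀) = inj₁ λ {g} g∈C → lookup⇒[]= g _ (Bool.∧-conicalʳ (Cₑ g) _
            (cycle-minimal C-cycle C₁ (λ f → Bool.∧-conicalˡ _ _) cycle∩side-even C₁f₀ g ([]=⇒lookup g∈C)))
    ... | no none = inj₂ λ {g} g∈C → [ (λ g∈H₁ → ⊥-elim (none (g , trans (cong (_∧ H₁ₑ g) ([]=⇒lookup g∈C)) ([]=⇒lookup g∈H₁))))
                                     , (λ g∈H₂ → g∈H₂) ]′ (x∈p∪q⁻ (edges X H₁) (edges X H₂) (C⊆H₁∪H₂ g∈C))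

  CactusOn : Subset nE → Set
  CactusOn Es = ∀ {C D e} → IsCycle X C → IsCycle X D → edges X C ⊆ Es → edges X D ⊆ Es →
                e ∈ edges X C → e ∈ edges X D → C ≡ D

  InS⇒cactus : ∀ {H} → InS X H → IsSubgraph X H × CactusOn (edges X H)
  InS⇒cactus (cyc H-cycle) = proj₁ H-cycle , λ C-cycle D-cycle C⊆H D⊆H _ _ →
    trans (cycle-⊆⇒≡ C-cycle H-cycle C⊆H) (sym (cycle-⊆⇒≡ D-cycle H-cycle D⊆H))
  InS⇒cactus {H} (join {H₁} {H₂} H₁∈S H₂∈S (w , shares) refl refl) = H-sub , H-cactus
    where
    H₁-sub = proj₁ (InS⇒cactus H₁∈S)
    H₂-sub = proj₁ (InS⇒cactus H₂∈S)
    H-sub : IsSubgraph X H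
    H-sub f f∈H with x∈p∪q⁻ (edges X H₁) (edges X H₂) f∈H
    ... | inj₁ f∈H₁ = x∈p∪q⁺ (inj₁ (proj₁ (H₁-sub f f∈H₁))) , x∈p∪q⁺ (inj₁ (proj₂ (H₁-sub f f∈H₁)))
    ... | inj₂ f∈H₂ = x∈p∪q⁺ (inj₂ (proj₁ (H₂-sub f f∈H₂))) , x∈p∪q⁺ (inj₂ (proj₂ (H₂-sub f f∈H₂)))
    -- an edge in both sides would have both ends equal to w
    not-both : ∀ {e} → e ∈ edges X H₁ → e ∈ edges X H₂ → ⊥
    not-both {e} e∈H₁ e∈H₂ = loopless e (trans (Equivalence.to (shares (end₁ e)) (proj₁ (H₁-sub e e∈H₁) , proj₁ (H₂-sub e e∈H₂)))
                                          (sym (Equivalence.to (shares (end₂ e)) (proj₂ (H₁-sub e e∈H₁) , proj₂ (H₂-sub e e∈H₂)))))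
    H-cactus : CactusOn (edges X H)
    H-cactus C-cycle D-cycle C⊆H D⊆H e∈C e∈D
      with cycle-in-one-side H₁-sub H₂-sub shares C-cycle C⊆H | cycle-in-one-side H₁-sub H₂-sub shares D-cycle D⊆H
    ... | inj₁ C⊆H₁ | inj₁ D⊆H₁ = proj₂ (InS⇒cactus H₁∈S) C-cycle D-cycle C⊆H₁ D⊆H₁ e∈C e∈D
    ... | inj₂ C⊆H₂ | inj₂ D⊆H₂ = proj₂ (InS⇒cactus H₂∈S) C-cycle D-cycle C⊆H₂ D⊆H₂ e∈C e∈D
    ... | inj₁ C⊆H₁ | inj₂ D⊆H₂ = ⊥-elim (not-both (C⊆H₁ e∈C) (D⊆H₂ e∈D))
    ... | inj₂ C⊆H₂ | inj₁ D⊆H₁ = ⊥-elim (not-both (D⊆H₁ e∈D) (C⊆H₂ e∈C))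

  cond5⇒cond1 : Cond5 X → Cond1 X
  cond5⇒cond1 c5 H K H-cycle K-cycle H≢K e e∈H e∈K = H≢K (proj₂ (InS⇒cactus c5) H-cycle K-cycle (λ _ → ∈⊤) (λ _ → ∈⊤) e∈H e∈K)

  -- Spanning forests and fundamental cycles

  Roots : (Fin nV → Fin nV) → Fin nV → Bool
  Roots root v = root v ≐ v

  record Forest : Set where
    field
      tree      : EdgeSet
      root      : Fin nV → Fin nV
      toRoot    : ∀ v → Walk X (toSubset tree) v (root v)
      tree-root : ∀ f → tree f ≡ true → root (end₁ f) ≡ root (end₂ f)
      root-idem : ∀ v → root (root v) ≡ root v
      size      : count (Roots root) + count tree ≡ nV

  empty-forest : Forest
  empty-forest = record
    { tree = λ _ → false ; root = λ v → v ; toRoot = λ _ → stop ; tree-root = λ _ () ; root-idem = λ _ → refl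
    ; size = trans (cong₂ _+_ (count-all ≐-refl) (count-none {nE} λ _ → refl)) (+-identityʳ nV) }

  module AddEdge (F : Forest) (f : Fin nE) (r₁≢r₂ : Forest.root F (end₁ f) ≢ Forest.root F (end₂ f)) where
    open Forest F

    r₁ r₂ : Fin nV
    r₁ = root (end₁ f)
    r₂ = root (end₂ f)

    redirect : Fin nV → Fin nV
    redirect x with x ≟ r₂
    ... | yes _ = r₁
    ... | no  _ = x

    redirect-cases : ∀ x → (x ≡ r₂ × redirect x ≡ r₁) ⊎ (x ≢ r₂ × redirect x ≡ x)
    redirect-cases x with x ≟ r₂
    ... | yes x≡r₂ = inj₁ (x≡r₂ , refl)
    ... | no  x≢r₂ = inj₂ (x≢r₂ , refl)

    redirect-r₁ : redirect r₁ ≡ r₁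
    redirect-r₁ with redirect-cases r₁
    ... | inj₁ (r₁≡r₂ , _) = ⊥-elim (r₁≢r₂ r₁≡r₂)
    ... | inj₂ (_ , eq)    = eq

    redirect-r₂ : redirect r₂ ≡ r₁
    redirect-r₂ with redirect-cases r₂
    ... | inj₁ (_ , eq)    = eq
    ... | inj₂ (r₂≢r₂ , _) = ⊥-elim (r₂≢r₂ refl)

    tree′ : EdgeSet
    tree′ g = tree g ∨ g ≐ f

    root′ : Fin nV → Fin nV
    root′ = redirect ∘ root

    grow : ∀ {u v} → Walk X (toSubset tree) u v → Walk X (toSubset tree′) u v
    grow = Walk-mono (λ g g∈ → ∈-toSubset⁺ (cong (_∨ g ≐ f) (∈-toSubset⁻ g∈)))

    f∈tree′ : f ∈ toSubset tree′
    f∈tree′ = ∈-toSubset⁺ (trans (cong (tree f ∨_) (≐-refl f)) (Bool.∨-zeroʳ (tree f)))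

    toRoot′ : ∀ v → Walk X (toSubset tree′) v (root′ v)
    toRoot′ v with redirect-cases (root v)
    ... | inj₂ (_ , eq) = subst (Walk X _ v) (sym eq) (grow (toRoot v))
    ... | inj₁ (root≡r₂ , eq) = subst (Walk X _ v) (sym eq)
          (grow (subst (Walk X _ v) root≡r₂ (toRoot v)) ++ʷ grow (reverseʷ (toRoot (end₂ f)))
           ++ʷ step f f∈tree′ (inj₂ refl) (grow (toRoot (end₁ f))))

    tree-root′ : ∀ g → tree′ g ≡ true → root′ (end₁ g) ≡ root′ (end₂ g)
    tree-root′ g g∈ with tree g in tg | g ≟ f
    ... | true  | _        = cong redirect (tree-root g tg)
    ... | false | yes refl = trans redirect-r₁ (sym redirect-r₂)

    root-idem′ : ∀ v → root′ (root′ v) ≡ root′ v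
    root-idem′ v with redirect-cases (root v)
    ... | inj₁ (_ , eq) = trans (cong (redirect ∘ root) eq) (trans (cong redirect (root-idem (end₁ f))) (trans redirect-r₁ (sym eq)))
    ... | inj₂ (_ , eq) = trans (cong (redirect ∘ root) eq) (cong redirect (root-idem v))

    roots′ : ∀ v → Roots root′ v ≡ (Roots root ∖ r₂) v
    roots′ v with v ≟ r₂ | redirect-cases (root v)
    ... | yes refl | inj₁ (_ , eq)        = trans (cong (_≐ r₂) eq) (trans (dec-false (r₁ ≟ r₂) r₁≢r₂) (sym (Bool.∧-zeroʳ _)))
    ... | yes refl | inj₂ (root≢r₂ , _)   = ⊥-elim (root≢r₂ (root-idem (end₂ f)))
    ... | no v≢r₂  | inj₂ (_ , eq)        = trans (cong (_≐ v) eq) (sym (Bool.∧-identityʳ _))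
    ... | no v≢r₂  | inj₁ (root≡r₂ , eq) =
      trans (cong (_≐ v) eq) (trans (dec-false (r₁ ≟ v) r₁≢v) (sym (trans (Bool.∧-identityʳ _) (dec-false (root v ≟ v) root≢v))))
      where
      r₁≢v : r₁ ≢ v
      r₁≢v r₁≡v = r₁≢r₂ (trans (sym (root-idem (end₁ f))) (trans (cong root r₁≡v) root≡r₂))
      root≢v : root v ≢ v
      root≢v root≡v = v≢r₂ (trans (sym root≡v) root≡r₂)

    tree′∖f : ∀ g → (tree′ ∖ f) g ≡ tree g
    tree′∖f g with g ≟ f
    ... | yes refl = trans (Bool.∧-zeroʳ _) (sym (Bool.¬-not (r₁≢r₂ ∘ tree-root f)))
    ... | no  _    = trans (Bool.∧-identityʳ _) (Bool.∨-identityʳ (tree g))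

    size′ : count (Roots root′) + count tree′ ≡ nV
    size′ = begin
      count (Roots root′) + count tree′                ≡⟨ cong₂ _+_ (count-cong roots′) (count-∖ tree′ (f∈tree′-bool)) ⟩
      count (Roots root ∖ r₂) + suc (count (tree′ ∖ f)) ≡⟨ cong (λ n → count (Roots root ∖ r₂) + suc n) (count-cong tree′∖f) ⟩
      count (Roots root ∖ r₂) + suc (count tree)       ≡⟨ +-suc _ (count tree) ⟩
      suc (count (Roots root ∖ r₂)) + count tree       ≡⟨ cong (_+ count tree) (sym (count-∖ (Roots root) (r₂-root))) ⟩
      count (Roots root) + count tree                  ≡⟨ size ⟩
      nV                                               ∎
      where
      open ≡-Reasoning
      f∈tree′-bool : tree′ f ≡ true
      f∈tree′-bool = ∈-toSubset⁻ f∈tree′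
      r₂-root : Roots root r₂ ≡ true
      r₂-root = trans (cong (_≐ r₂) (root-idem (end₂ f))) (≐-refl r₂)

    forest : Forest
    forest = record { tree = tree′ ; root = root′ ; toRoot = toRoot′ ; tree-root = tree-root′ ; root-idem = root-idem′ ; size = size′ }

  Closes : Forest → Fin nE → Set
  Closes F f = Forest.root F (end₁ f) ≡ Forest.root F (end₂ f)

  forest-closing : (L : List (Fin nE)) → Σ Forest λ F → ∀ {f} → f ∈ₗ L → Closes F f
  forest-closing []      = empty-forest , λ ()
  forest-closing (f ∷ L) with forest-closing L
  ... | F , closes with Forest.root F (end₁ f) ≟ Forest.root F (end₂ f)
  ...   | yes closes-f = F , λ { (here refl) → closes-f ; (there g∈L) → closes g∈L }
  ...   | no  r₁≢r₂    = AddEdge.forest F f r₁≢r₂ , λ { (here refl) → AddEdge.tree-root′ F f r₁≢r₂ f (∈-toSubset⁻ (AddEdge.f∈tree′ F f r₁≢r₂))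
                                                       ; (there g∈L) → cong (AddEdge.redirect F f r₁≢r₂) (closes g∈L) }

  spanning-forest : Σ Forest λ F → ∀ f → Closes F f
  spanning-forest = let (F , closes) = forest-closing (allFin nE) in F , λ f → closes (∈-allFin f)

  module Fundamental (F : Forest) (closes : ∀ f → Closes F f) where
    open Forest F
    open DecMembership Sub-≟ using () renaming (_∈?_ to _∈ₛ?_)

    closingWalk : ∀ f → Walk X (toSubset tree) (end₂ f) (end₁ f)
    closingWalk f = toRoot (end₂ f) ++ʷ subst (λ r → Walk X _ r (end₁ f)) (closes f) (reverseʷ (toRoot (end₁ f)))

    fundamentalCycle : Fin nE → Sub X
    fundamentalCycle f = closingCycle tree (inj₁ refl) (closingWalk f)

    fundamental : ∀ {f} → tree f ≡ false → CycleWithin (λ g → g ≐ f ∨ tree g) f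
    fundamental {f} f∉tree = cycle-closing tree (inj₁ refl) f∉tree (closingWalk f)

    fundamental-non-tree : ∀ {f g} → tree f ≡ false → g ∈ edges X (fundamentalCycle f) → tree g ≡ false → g ≡ f
    fundamental-non-tree {f} {g} f∉tree g∈ g∉tree with g ≟ f
    ... | yes g≡f = g≡f
    ... | no  g≢f = ⊥-elim (Bool.not-¬ (CycleWithin.⊆F (fundamental f∉tree) g g∈) (cong₂ _∨_ (dec-false (g ≟ f) g≢f) g∉tree))

    fundamental-≡ : ∀ {d h} → tree d ≡ false → h ∈ edges X (fundamentalCycle d) → tree h ≡ false →
                    fundamentalCycle d ≡ fundamentalCycle h
    fundamental-≡ d∉tree h∈ h∉tree = cong fundamentalCycle (sym (fundamental-non-tree d∉tree h∈ h∉tree))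

    ∋-fundamental : ∀ f → f ∈ edges X (fundamentalCycle f)
    ∋-fundamental f = ClosePath.∋e tree (inj₁ refl) (proj₁ (toPath (closingWalk f))) (proj₂ (toPath (closingWalk f)))

    nonTree? : ∀ f → Dec (tree f ≡ false)
    nonTree? f = tree f Bool.≟ false

    nonTreeEdges : List (Fin nE)
    nonTreeEdges = filter nonTree? (allFin nE)

    fundamentals : List (Sub X)
    fundamentals = map fundamentalCycle nonTreeEdges

    ∈-fundamentals⁻ : ∀ {D} → D ∈ₗ fundamentals → ∃ λ f → tree f ≡ false × D ≡ fundamentalCycle f
    ∈-fundamentals⁻ D∈ = let (f , f∈ , D≡) = ∈-map⁻ fundamentalCycle D∈ in f , proj₂ (∈-filter⁻ nonTree? {xs = allFin nE} f∈) , D≡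

    fundamentals-unique : Unique fundamentals
    fundamentals-unique = map⁺-on injective (filter⁺ nonTree? (allFin⁺ nE))
      where
      injective : ∀ {f g} → f ∈ₗ nonTreeEdges → g ∈ₗ nonTreeEdges → fundamentalCycle f ≡ fundamentalCycle g → f ≡ g
      injective {f} f∈ g∈ eq = fundamental-non-tree (proj₂ (∈-filter⁻ nonTree? {xs = allFin nE} g∈))
                                                    (subst (λ D → f ∈ edges X D) eq (∋-fundamental f))
                                                    (proj₂ (∈-filter⁻ nonTree? {xs = allFin nE} f∈))

    fundamentals-cycles : ∀ {D} → D ∈ₗ fundamentals → IsCycle X D
    fundamentals-cycles D∈ = let (_ , f∉tree , D≡) = ∈-fundamentals⁻ D∈ in subst (IsCycle X) (sym D≡) (CycleWithin.isCycle (fundamental f∉tree))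

    length-fundamentals : length fundamentals + nV ≡ nE + count (Roots root)
    length-fundamentals = begin
      length fundamentals + nV                                           ≡⟨ cong (_+ nV) (length-map fundamentalCycle nonTreeEdges) ⟩
      length nonTreeEdges + nV                                 ≡⟨ cong (_+ nV) (length-filter-tabulate nonTree? (λ f → f)) ⟩
      count (λ f → does (nonTree? f)) + nV                     ≡⟨ cong (_+ nV) (count-cong (λ f → does-≡false (tree f))) ⟩
      count (not ∘ tree) + nV                                  ≡⟨ cong (count (not ∘ tree) +_) (sym size) ⟩
      count (not ∘ tree) + (count (Roots root) + count tree)   ≡⟨ regroup (count (not ∘ tree)) (count (Roots root)) (count tree) ⟩
      (count tree + count (not ∘ tree)) + count (Roots root)   ≡⟨ cong (_+ count (Roots root)) (count-complement tree) ⟩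
      nE + count (Roots root)                                  ∎
      where
      open ≡-Reasoning
      regroup : ∀ a b c → a + (b + c) ≡ (c + a) + b
      regroup = solve-∀
      does-≡false : ∀ b → does (b Bool.≟ false) ≡ not b
      does-≡false false = refl
      does-≡false true  = refl

    roots-pos : Fin nV → 1 ≤ count (Roots root)
    roots-pos v = count-pos⁺ (Roots root) (trans (cong (_≐ root v) (root-idem v)) (≐-refl (root v)))

    -- The symmetric difference of two fundamental cycles through e is even and contains the non-tree
    -- edge of the first but not e; a cycle through that edge inside it is no fundamental cycle.
    non-fundamental-cycle : ∀ {H K e} → IsCycle X H → IsCycle X K → H ≢ K → e ∈ edges X H → e ∈ edges X K →
                            ∃ λ Z → IsCycle X Z × Z ∉ₗ fundamentals
    non-fundamental-cycle {H} {K} {e} H-cycle K-cycle H≢K e∈H e∈K with H ∈ₛ? fundamentals | K ∈ₛ? fundamentals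
    ... | no H∉Fs  | _        = H , H-cycle , H∉Fs
    ... | yes _    | no K∉Fs  = K , K-cycle , K∉Fs
    ... | yes H∈Fs | yes K∈Fs with ∈-fundamentals⁻ H∈Fs | ∈-fundamentals⁻ K∈Fs
    ...   | f , f∉tree , refl | g , g∉tree , refl = CycleWithin.cycle Z , CycleWithin.isCycle Z , Z∉Fs
      where
      Hₑ = lookup (edges X (fundamentalCycle f))
      Kₑ = lookup (edges X (fundamentalCycle g))
      f∉K : Kₑ f ≡ false
      f∉K = Bool.¬-not λ Kf → H≢K (sym (fundamental-≡ g∉tree (lookup⇒[]= f _ Kf) f∉tree))
      f∈Δ : (Hₑ f xor Kₑ f) ≡ true
      f∈Δ = cong₂ _xor_ ([]=⇒lookup (∋-fundamental f)) f∉K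
      Z = cycle-through (λ h → Hₑ h xor Kₑ h) (even-xor Hₑ Kₑ (cycle-even H-cycle) (cycle-even K-cycle)) f∈Δ
      e∉Z : e ∉ edges X (CycleWithin.cycle Z)
      e∉Z e∈Z = Bool.not-¬ (CycleWithin.⊆F Z e e∈Z) (cong₂ _xor_ ([]=⇒lookup e∈H) ([]=⇒lookup e∈K))
      Z∉Fs : CycleWithin.cycle Z ∉ₗ fundamentals
      Z∉Fs Z∈Fs with ∈-fundamentals⁻ Z∈Fs
      ... | h , h∉tree , Z≡ with xor-true (CycleWithin.⊆F Z h (subst (λ D → h ∈ edges X D) (sym Z≡) (∋-fundamental h)))
      ...   | inj₁ Hh = e∉Z (subst (λ D → e ∈ edges X D) (trans (fundamental-≡ f∉tree (lookup⇒[]= h _ Hh) h∉tree) (sym Z≡)) e∈H)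
      ...   | inj₂ Kh = e∉Z (subst (λ D → e ∈ edges X D) (trans (fundamental-≡ g∉tree (lookup⇒[]= h _ Kh) h∉tree) (sym Z≡)) e∈K)

  -- Rebuilding X from a cycle decomposition

  module Assemblies (connected : Connected X) (D : Decomposition (λ _ → true)) where
    module D = Decomposition D

    -- The part is the union of the cycles in used, each attached to the earlier ones at one or
    -- more vertices; defect counts shared vertices beyond one per attachment, so it is 0 exactly
    -- when every attachment was a ∗-product.
    record Assembly : Set where
      field
        part        : Sub X
        used        : List (Sub X)
        defect      : ℕ
        inhabited   : ∃ λ v → v ∈ verts X part
        part-sub    : IsSubgraph X part
        used-unique : Unique used
        used⊆       : ∀ {C} → C ∈ₗ used → C ∈ₗ D.cycles
        covered     : ∀ {g} → g ∈ edges X part → ∃ λ C → C ∈ₗ used × g ∈ edges X C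
        used⊆part   : ∀ {C g} → C ∈ₗ used → g ∈ edges X C → g ∈ edges X part
        balance     : count (lookup (verts X part)) + length used + defect ≡ count (lookup (edges X part)) + 1
        defect-0    : defect ≡ 0 → InS X part

      missing : ℕ
      missing = count (not ∘ lookup (edges X part))

    initial : Fin nE → Assembly
    initial e = record
      { part = C ; used = C ∷ [] ; defect = 0
      ; inhabited = let (f , f∈C) = cycle-edge C-cycle in end₁ f , proj₁ (proj₁ C-cycle f f∈C)
      ; part-sub = proj₁ C-cycle ; used-unique = All.[] ∷ [] ; used⊆ = λ { (here refl) → C∈ }
      ; covered = λ g∈C → C , here refl , g∈C ; used⊆part = λ { (here refl) g∈C → g∈C }
      ; balance = trans (+-identityʳ _) (cong (_+ 1) (cycle-size C-cycle))
      ; defect-0 = λ _ → cyc C-cycle }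
      where
      C = proj₁ (D.cover e refl)
      C∈ = proj₁ (proj₂ (D.cover e refl))
      C-cycle = D.isCycle C∈

    record Attachment (A : Assembly) : Set where
      open Assembly A
      field
        cycle         : Sub X
        ∈cycles       : cycle ∈ₗ D.cycles
        outside       : ∀ {h} → h ∈ edges X cycle → h ∉ edges X part
        contact       : Fin nV
        contact∈part  : contact ∈ verts X part
        contact∈cycle : contact ∈ verts X cycle

    -- A cycle of the decomposition with one edge outside the part has all its edges outside,
    -- since the cycles used so far cover the part and the decomposition is edge-disjoint.
    attachment : (A : Assembly) → ∀ {g} → g ∉ edges X (Assembly.part A) → Attachment A
    attachment A {g} g∉part = along (proj₂ connected _ (end₁ g)) (proj₂ inhabited)
      where
      open Assembly A
      outside : ∀ {C h} → C ∈ₗ D.cycles → h ∈ edges X C → h ∉ edges X part → ∀ {h′} → h′ ∈ edges X C → h′ ∉ edges X part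
      outside C∈ h∈C h∉part h′∈C h′∈part =
        let (C′ , C′∈ , h′∈C′) = covered h′∈part in
        h∉part (used⊆part C′∈ (subst (λ H → _ ∈ edges X H) (D.disjoint C∈ (used⊆ C′∈) h′∈C h′∈C′) h∈C))
      at : ∀ {h z w} → Joins X h z w → h ∉ edges X part → z ∈ verts X part → Attachment A
      at {h} {z} j h∉part z∈part = record
        { cycle = C ; ∈cycles = C∈ ; outside = outside C∈ h∈C h∉part ; contact = z ; contact∈part = z∈part
        ; contact∈cycle = subgraph-incident∈ (proj₁ (D.isCycle C∈)) h∈C (Joins⇒incident₁ j) }
        where
        C = proj₁ (D.cover h refl)
        C∈ = proj₁ (proj₂ (D.cover h refl))
        h∈C = proj₂ (proj₂ (D.cover h refl))
      along : ∀ {z} → Walk X ⊤ z (end₁ g) → z ∈ verts X part → Attachment A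
      along stop z∈part = at (inj₁ refl) g∉part z∈part
      along (step h _ j rest) z∈part with h ∈? edges X part
      ... | no  h∉part = at j h∉part z∈part
      ... | yes h∈part = along rest (subgraph-incident∈ part-sub h∈part (Joins⇒incident₂ j))

    module Attach (A : Assembly) (T : Attachment A) where
      open Assembly A
      open Attachment T renaming (cycle to C)

      C-cycle = D.isCycle ∈cycles
      Pᵥ = lookup (verts X part)
      Pₑ = lookup (edges X part)
      Cᵥ = lookup (verts X C)
      Cₑ = lookup (edges X C)

      shared : ℕ
      shared = count (λ v → Pᵥ v ∧ Cᵥ v)

      shared-pos : 1 ≤ shared
      shared-pos = count-pos⁺ (λ v → Pᵥ v ∧ Cᵥ v) (cong₂ _∧_ ([]=⇒lookup contact∈part) ([]=⇒lookup contact∈cycle))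

      extra : ℕ
      extra = shared ∸ 1

      part′ : Sub X
      part′ = verts X part ∪ verts X C , edges X part ∪ edges X C

      edge-count′ : count (lookup (edges X part′)) ≡ count Pₑ + count Cₑ
      edge-count′ = trans (sym (+-identityʳ _)) (trans (cong (count (lookup (edges X part′)) +_) (sym (count-none disjoint)))
                          (count-∪ (edges X part) (edges X C)))
        where
        disjoint : ∀ h → (Pₑ h ∧ Cₑ h) ≡ false
        disjoint h = Bool.¬-not λ Ph∧Ch →
          outside (lookup⇒[]= h _ (Bool.∧-conicalʳ (Pₑ h) _ Ph∧Ch)) (lookup⇒[]= h _ (Bool.∧-conicalˡ _ _ Ph∧Ch))

      balance′ : count (lookup (verts X part′)) + length (C ∷ used) + (defect + extra) ≡ count (lookup (edges X part′)) + 1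
      balance′ = begin
        count V′ + suc (length used) + (defect + extra)   ≡⟨ regroup (count V′) (length used) defect extra ⟩
        (count V′ + suc extra) + length used + defect     ≡⟨ cong (λ n → count V′ + n + length used + defect) (m+[n∸m]≡n shared-pos) ⟩
        (count V′ + shared) + length used + defect        ≡⟨ cong (λ n → n + length used + defect) (count-∪ (verts X part) (verts X C)) ⟩
        (count Pᵥ + count Cᵥ) + length used + defect      ≡⟨ regroup′ (count Pᵥ) (count Cᵥ) (length used) defect ⟩
        (count Pᵥ + length used + defect) + count Cᵥ      ≡⟨ cong₂ _+_ balance (cycle-size C-cycle) ⟩
        (count Pₑ + 1) + count Cₑ                         ≡⟨ regroup″ (count Pₑ) (count Cₑ) ⟩
        (count Pₑ + count Cₑ) + 1                         ≡⟨ cong (_+ 1) (sym edge-count′) ⟩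
        count (lookup (edges X part′)) + 1                ∎
        where
        open ≡-Reasoning
        V′ = lookup (verts X part′)
        regroup : ∀ a b c d → a + suc b + (c + d) ≡ (a + suc d) + b + c
        regroup = solve-∀
        regroup′ : ∀ a b c d → (a + b) + c + d ≡ (a + c + d) + b
        regroup′ = solve-∀
        regroup″ : ∀ a b → (a + 1) + b ≡ (a + b) + 1
        regroup″ = solve-∀

      defect-0′ : defect + extra ≡ 0 → InS X part′
      defect-0′ d+e≡0 = join (defect-0 (m+n≡0⇒m≡0 defect d+e≡0)) (cyc C-cycle)
                             (contact , λ u → mk⇔ (only u) λ { refl → contact∈part , contact∈cycle }) refl refl
        where
        shared≡1 : shared ≡ 1
        shared≡1 = trans (sym (m+[n∸m]≡n shared-pos)) (cong suc (m+n≡0⇒n≡0 defect d+e≡0))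
        only : ∀ u → u ∈ verts X part × u ∈ verts X C → u ≡ contact
        only u (u∈part , u∈C) with u ≟ contact
        ... | yes u≡contact = u≡contact
        ... | no  u≢contact = ⊥-elim (<-irrefl refl (≤-trans (≤-reflexive (sym (count-pair u≢contact)))
                                                          (subst (count (λ v → v ≐ u ∨ v ≐ contact) ≤_) shared≡1 (count-mono both))))
          where
          both : (λ v → v ≐ u ∨ v ≐ contact) ⊆ᵇ (λ v → Pᵥ v ∧ Cᵥ v)
          both v h with v ≟ u | v ≟ contact
          ... | yes refl | _        = cong₂ _∧_ ([]=⇒lookup u∈part) ([]=⇒lookup u∈C)
          ... | no _     | yes refl = cong₂ _∧_ ([]=⇒lookup contact∈part) ([]=⇒lookup contact∈cycle)

      part-sub′ : IsSubgraph X part′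
      part-sub′ f f∈ with x∈p∪q⁻ (edges X part) (edges X C) f∈
      ... | inj₁ f∈P = x∈p∪q⁺ (inj₁ (proj₁ (part-sub f f∈P))) , x∈p∪q⁺ (inj₁ (proj₂ (part-sub f f∈P)))
      ... | inj₂ f∈C = x∈p∪q⁺ (inj₂ (proj₁ (proj₁ C-cycle f f∈C))) , x∈p∪q⁺ (inj₂ (proj₂ (proj₁ C-cycle f f∈C)))

      C∉used : All.All (C ≢_) used
      C∉used = All.tabulate λ D∈ C≡D → let (h , h∈C) = cycle-edge C-cycle in
        outside h∈C (used⊆part D∈ (subst (λ H → h ∈ edges X H) C≡D h∈C))

      assembly′ : Assembly
      assembly′ = record
        { part = part′ ; used = C ∷ used ; defect = defect + extra
        ; inhabited = let (v , v∈) = inhabited in v , x∈p∪q⁺ (inj₁ v∈)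
        ; part-sub = part-sub′
        ; used-unique = C∉used ∷ used-unique
        ; used⊆ = λ { (here refl) → ∈cycles ; (there D∈) → used⊆ D∈ }
        ; covered = λ {g} g∈ → [ (λ g∈P → let (D , D∈ , g∈D) = covered g∈P in D , there D∈ , g∈D)
                                , (λ g∈C → C , here refl , g∈C) ]′ (x∈p∪q⁻ (edges X part) (edges X C) g∈)
        ; used⊆part = λ { (here refl) g∈C → x∈p∪q⁺ (inj₂ g∈C) ; (there D∈) g∈D → x∈p∪q⁺ (inj₁ (used⊆part D∈ g∈D)) }
        ; balance = balance′
        ; defect-0 = defect-0′
        }

      missing-decreases : Assembly.missing assembly′ < missing
      missing-decreases = subst (_< missing) (count-cong still-missing)
                                (count-−< (not ∘ Pₑ) Cₑ {h} (cong not (Bool.¬-not (outside h∈C ∘ lookup⇒[]= h _))) ([]=⇒lookup h∈C))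
        where
        h = proj₁ (cycle-edge C-cycle)
        h∈C = proj₂ (cycle-edge C-cycle)
        still-missing : ∀ g → not (Pₑ g) ∧ not (Cₑ g) ≡ not (lookup (edges X part′) g)
        still-missing g = sym (trans (cong not (lookup-zipWith _∨_ g (edges X part) (edges X C))) (not-∨ (Pₑ g)))
          where
          not-∨ : ∀ a {b} → not (a ∨ b) ≡ not a ∧ not b
          not-∨ false = refl
          not-∨ true  = refl

    complete : (A : Assembly) → Σ Assembly λ A′ → ∀ g → g ∈ edges X (Assembly.part A′)
    complete A = go (Assembly.missing A) A ≤-refl
      where
      go : ∀ fuel (A : Assembly) → Assembly.missing A ≤ fuel → Σ Assembly λ A′ → ∀ g → g ∈ edges X (Assembly.part A′)
      go fuel A size with all? (λ g → g ∈? edges X (Assembly.part A))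
      ... | yes all-in = A , all-in
      ... | no  ¬all-in with ¬∀⟶∃¬ nE _ (λ g → g ∈? edges X (Assembly.part A)) ¬all-in
      ...   | g , g∉ with fuel | Attach.missing-decreases A (attachment A g∉)
      ...     | zero     | smaller with () ← <-≤-trans smaller size
      ...     | suc fuel | smaller = go fuel (Attach.assembly′ A (attachment A g∉)) (≤-pred (<-≤-trans smaller size))

    module Complete (A : Assembly) (all-edges : ∀ g → g ∈ edges X (Assembly.part A)) where
      open Assembly A

      all-vertices : ∀ v → v ∈ verts X part
      all-vertices v = reach (proj₂ connected v (proj₁ inhabited)) (proj₂ inhabited)
        where
        reach : ∀ {v w} → Walk X ⊤ v w → w ∈ verts X part → v ∈ verts X part
        reach stop              w∈ = w∈
        reach (step h _ j rest) _  = subgraph-incident∈ part-sub (all-edges h) (Joins⇒incident₁ j)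

      part≡⊤ : part ≡ (⊤ , ⊤)
      part≡⊤ = cong₂ _,_ (⊆-antisym ⊆⊤ λ {v} _ → all-vertices v) (⊆-antisym ⊆⊤ λ {g} _ → all-edges g)

      complete-balance : nV + length used + defect ≡ nE + 1
      complete-balance = trans (cong (λ n → n + length used + defect) (sym (count-all (λ v → []=⇒lookup (all-vertices v)))))
                               (trans balance (cong (_+ 1) (count-all (λ g → []=⇒lookup (all-edges g)))))

      complete-InS : defect ≡ 0 → InS X (⊤ , ⊤)
      complete-InS d≡0 = subst (InS X) part≡⊤ (defect-0 d≡0)

  cond1⇒cond5×cond6 : Connected X → Eulerian X → 0 < nE → Cond1 X → Cond5 X × Cond6 X
  cond1⇒cond5×cond6 connected eulerian nE>0 c1 =
    complete-InS defect≡0 , length used , (used , used-unique , (λ H → mk⇔ (D.isCycle ∘ used⊆) used∋) , refl) , rank-ℕ⇒ℤ rank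
    where
    D = decompose (λ _ → true) (eulerian⇒even eulerian)
    open Assemblies connected D
    A = complete (initial (fromℕ< nE>0))
    open Complete (proj₁ A) (proj₂ A)
    open Assembly (proj₁ A)
    F = spanning-forest
    open Fundamental (proj₁ F) (proj₂ F)
    used∋ : ∀ {H} → IsCycle X H → H ∈ₗ used
    used∋ H-cycle = let (e , e∈H) = cycle-edge H-cycle ; (C , C∈ , e∈C) = covered (proj₂ A e) in
      subst (_∈ₗ used) (cond1⇒sharing-cycles-≡ c1 (D.isCycle (used⊆ C∈)) H-cycle e∈C e∈H) C∈
    defect≡0 : defect ≡ 0
    defect≡0 = defect-vanishes complete-balance length-fundamentals (roots-pos (proj₁ connected)) (unique-⊆⇒length-≤ fundamentals-unique (used∋ ∘ fundamentals-cycles))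
    rank : length used + nV ≡ nE + 1
    rank = trans (+-comm (length used) nV) (trans (sym (+-identityʳ _)) (trans (cong (nV + length used +_) (sym defect≡0)) complete-balance))

  cond6⇒cond1 : Connected X → Cond6 X → Cond1 X
  cond6⇒cond1 connected (k , (L , _ , L-cycles , length-L) , rank) H K H-cycle K-cycle H≢K e e∈H e∈K =
    rank-too-small {nV} {nE} (rank-ℤ⇒ℕ {nE} {nV} rank) length-fundamentals (roots-pos (proj₁ connected))
      (subst (suc (length fundamentals) ≤_) length-L (unique-⊆⇒length-≤ (Z∉Fs′ ∷ fundamentals-unique) in-L))
    where
    F = spanning-forest
    open Fundamental (proj₁ F) (proj₂ F)
    Z′ = non-fundamental-cycle H-cycle K-cycle H≢K e∈H e∈K
    Z = proj₁ Z′
    Z∉Fs = proj₂ (proj₂ Z′)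
    Z∉Fs′ : All (Z ≢_) fundamentals
    Z∉Fs′ = All.tabulate (λ D∈ Z≡D → Z∉Fs (subst (_∈ₗ fundamentals) (sym Z≡D) D∈))
    in-L : ∀ {D} → D ∈ₗ Z ∷ fundamentals → D ∈ₗ L
    in-L (here refl) = Equivalence.from (L-cycles Z) (proj₁ (proj₂ Z′))
    in-L (there D∈)  = Equivalence.from (L-cycles _) (fundamentals-cycles D∈)

mainTheorem3 : (X : Multigraph) → Connected X → Eulerian X → 0 < Multigraph.nE X →
    (Cond1 X ⇔ Cond2 X) × (Cond1 X ⇔ Cond3 X) × (Cond1 X ⇔ Cond4 X) ×
    (Cond1 X ⇔ Cond5 X) × (Cond1 X ⇔ Cond6 X)
mainTheorem3 X connected eulerian nE>0 =
  mk⇔ (cond1⇒cond2 X eulerian) (cond2⇒cond1 X) ,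
  mk⇔ (cond1⇒cond3 X eulerian) (cond3⇒cond1 X) ,
  mk⇔ (cond1⇒cond4 X eulerian) (cond4⇒cond1 X eulerian) ,
  mk⇔ (proj₁ ∘ cond1⇒cond5×cond6 X connected eulerian nE>0) (cond5⇒cond1 X) ,
  mk⇔ (proj₂ ∘ cond1⇒cond5×cond6 X connected eulerian nE>0) (cond6⇒cond1 X connected)
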